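{- Let $q$ be a power of a prime $p$, and let $f(x)=\sum_{n\geq 0}a_nx^n\in x\mathbb{F}_q[[x]]$ (so $f(0)=0$) be algebraic over $\mathbb{F}_q(x)$, of degree $d$ and height $h$. Let $P(x,y)\in\mathbb{F}_q[x,y]$ be the minimal polynomial of $f$. If $\frac{\partial P}{\partial y}(0,0)\neq 0$, then $$\mathrm{comp}_q(\mathbf{a})\leq 1+q^{(h+1)d},$$ where $\mathbf{a}=(a_n)_{n\geq 0}$.
   Context: The degree of $f$ is $[\mathbb{F}_q(x)(f):\mathbb{F}_q(x)]$; the height of $f$ is the minimal degree in $x$ of a nonzero polynomial $P(x,y)\in\mathbb{F}_q[x,y]$ with $P(x,f(x))=0$. The minimal polynomial of $f$ is an irreducible polynomial $P(x,y)\in\mathbb{F}_q[x,y]$ with $P(x,f(x))=0$ (of degree $d$ in $y$ and degree $h$ in $x$). For a $q$-automatic sequence $\mathbf{a}$, $\mathrm{comp}_q(\mathbf{a})$ denotes the number of states of a minimal deterministic finite automaton with output which, given the base-$q$ expansion of $n$ read starting from the least significant digit, outputs $a_n$; equivalently, it equals the cardinality of the $q$-kernel $\{(a_{q^rn+j})_{n\geq 0} : r\geq 0,\ 0\leq j<q^r\}$. -}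

module Defs where

open import Level using (Level; _⊔_)
open import Algebra.Bundles using (CommutativeRing)
open import Data.Nat as ℕ using (ℕ; zero; suc; _∸_; _<_; _≤_)
open import Data.Nat.Primality using (Prime)
open import Data.Fin using (Fin)
open import Data.Product using (Σ; _×_; ∃; ∃-syntax; _,_)
open import Data.Sum using (_⊎_)
open import Relation.Nullary using (¬_; yes; no)
open import Relation.Binary.PropositionalEquality using (_≡_)

record IsFiniteField {c ℓ : Level} (F : CommutativeRing c ℓ) (q : ℕ) : Set (c ⊔ ℓ) where
  open CommutativeRing F
  field
    1≉0     : ¬ (1# ≈ 0#)
    inverse : ∀ x → ¬ (x ≈ 0#) → ∃[ y ] (x * y ≈ 1#)
    enum    : Fin q → Carrier
    enum-inj : ∀ i j → enum i ≈ enum j → i ≡ j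
    enum-surj : ∀ x → ∃[ i ] (enum i ≈ x)

IsPrimePower : ℕ → Set
IsPrimePower q = Σ ℕ λ p → Σ ℕ λ k → Prime p × (1 ≤ k) × (q ≡ p ℕ.^ k)

module Over {c ℓ : Level} (F : CommutativeRing c ℓ) where
  open CommutativeRing F public

  sumTo : ℕ → (ℕ → Carrier) → Carrier
  sumTo zero    g = 0#
  sumTo (suc n) g = sumTo n g + g n

  Series : Set c
  Series = ℕ → Carrier

  oneS : Series
  oneS zero    = 1#
  oneS (suc n) = 0#

  _⊛_ : Series → Series → Series
  (s ⊛ t) n = sumTo (suc n) (λ i → s i * t (n ∸ i))

  powS : Series → ℕ → Series
  powS s zero    = oneS
  powS s (suc j) = s ⊛ powS s j

  -- bivariate polynomials in F[x,y], given by their coefficient function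
  -- P i j = coefficient of x^i y^j
  Poly2 : Set c
  Poly2 = ℕ → ℕ → Carrier

  BoundedBy : Poly2 → ℕ → ℕ → Set ℓ
  BoundedBy P a b = ∀ i j → (a < i ⊎ b < j) → P i j ≈ 0#

  IsPoly : Poly2 → Set ℓ
  IsPoly P = ∃[ a ] ∃[ b ] BoundedBy P a b

  IsZeroPoly : Poly2 → Set ℓ
  IsZeroPoly P = ∀ i j → P i j ≈ 0#

  IsConstant : Poly2 → Set ℓ
  IsConstant P = BoundedBy P 0 0

  -- units of F[x,y] are the nonzero constants
  IsUnit : Poly2 → Set ℓ
  IsUnit P = IsConstant P × ¬ (P 0 0 ≈ 0#)

  _⊗_ : Poly2 → Poly2 → Poly2
  (P ⊗ Q) i j = sumTo (suc i) λ a → sumTo (suc j) λ b → P a b * Q (i ∸ a) (j ∸ b)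

  Irreducible : Poly2 → Set (c ⊔ ℓ)
  Irreducible P =
    ¬ IsZeroPoly P × ¬ IsUnit P ×
    (∀ Q R → IsPoly Q → IsPoly R → (∀ i j → P i j ≈ (Q ⊗ R) i j) → IsUnit Q ⊎ IsUnit R)

  DegY : Poly2 → ℕ → Set ℓ
  DegY P d = (∀ i j → d < j → P i j ≈ 0#) × ∃[ i ] ¬ (P i d ≈ 0#)

  DegX : Poly2 → ℕ → Set ℓ
  DegX P h = (∀ i j → h < i → P i j ≈ 0#) × ∃[ j ] ¬ (P h j ≈ 0#)

  -- n-th coefficient of P(x, f(x)) for P with x-degree ≤ h and y-degree ≤ d
  evalCoeff : (P : Poly2) (h d : ℕ) → Series → ℕ → Carrier
  evalCoeff P h d f n =
    sumTo (suc h) λ i → sumTo (suc d) λ j → P i j * powS f j (n ∸ i) * δ i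
    where
      -- only terms with i ≤ n contribute to x^n
      δ : ℕ → Carrier
      δ i with i ℕ.≤? n
      ... | yes _ = 1#
      ... | no  _ = 0#

  ∂y : Poly2 → Poly2
  ∂y P i j = (suc j) ·ℕ P i (suc j)
    where open import Algebra.Properties.Monoid.Mult +-monoid renaming (_×_ to _·ℕ_)

  at00 : Poly2 → Carrier
  at00 P = P 0 0

  -- the q-kernel of a sequence a has at most N elements: there are N
  -- sequences s₀..s_{N-1} such that every kernel element (a (q^r n + j))_n,
  -- r ≥ 0, 0 ≤ j < q^r, is (pointwise ≈) equal to one of them.
  KernelCardAtMost : (q : ℕ) → Series → ℕ → Set (c ⊔ ℓ)
  KernelCardAtMost q a N =
    Σ (Fin N → Series) λ s →
      ∀ (r j : ℕ) → j < q ℕ.^ r →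
        ∃[ k ] (∀ n → a (q ℕ.^ r ℕ.* n ℕ.+ j) ≈ s k n)

kernelBound : (q h d : ℕ) → ℕ
kernelBound q h d = 1 ℕ.+ q ℕ.^ ((h ℕ.+ 1) ℕ.* d)

-- Since ∂P/∂y(0,0) ≠ 0, Furstenberg's residue argument writes f as the diagonal of S/Q, where
-- S = y·∂P/∂y(xy, y) and Q = P(xy, y)/y has the invertible constant term P(0,1).
-- The diagonal sections Λⱼ A(c, a) = A(qc + j, qa + j) satisfy Λⱼ(A/Q) = Λⱼ(A·Q^(q−1))/Q, because over 𝔽_q
-- the series Q^q is Q with x, y replaced by x^q, y^q (Frobenius and Fermat).
-- S is supported in {a ≤ h, 0 ≤ c − a ≤ d}, and each Λⱼ(A·Q^(q−1)) with A in that region lies in the smaller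
-- box {a ≤ h, 0 ≤ c − a ≤ d − 1}, which is then preserved. So the q-kernel of f consists of f and
-- diagonals of A/Q for the q^((h+1)d) numerators A supported in that box.

module Submission where

open import Defs
open import Level using (Level)
open import Algebra.Bundles using (CommutativeRing)
open import Data.Nat using (ℕ)
open import Relation.Nullary using (¬_)

open import Algebra.Structures using (IsCommutativeRing)
import Algebra.Properties.Semiring.Exp as Exp
import Algebra.Properties.Semiring.Mult as Mult
open import Data.Nat as ℕ using (zero; suc; _∸_; _<_; _≤_; z≤n; s≤s)
import Data.Nat.Properties as ℕP
open import Algebra.Properties.CommutativeSemigroup ℕP.+-commutativeSemigroup using (interchange)
open import Data.Empty using (⊥-elim)
open import Data.Product using (_,_; proj₁; proj₂; ∃-syntax)
open import Data.Sum as Sum using (_⊎_; inj₁; inj₂; [_,_])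
open import Function using (_∘_; id)
open import Relation.Binary using (tri<; tri≈; tri>)
import Relation.Binary.Reasoning.Setoid
open import Data.Nat.Tactic.RingSolver using (solve-∀)
open import Relation.Nullary using (yes; no; Dec)
open import Data.Nat.Primality using (Prime)
open import Relation.Binary.PropositionalEquality as ≡ using (_≡_; _≢_)

module FiniteSums {c ℓ} (R : CommutativeRing c ℓ) where
  open Over R
  open import Relation.Binary.Reasoning.Setoid setoid
  open import Algebra.Solver.Ring.NaturalCoefficients.Default commutativeSemiring

  sumTo-cong-< : ∀ n {f g : ℕ → Carrier} → (∀ i → i < n → f i ≈ g i) → sumTo n f ≈ sumTo n g
  sumTo-cong-< zero    e = refl
  sumTo-cong-< (suc n) e = +-cong (sumTo-cong-< n (λ i i<n → e i (ℕP.m<n⇒m<1+n i<n))) (e n (ℕP.n<1+n n))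

  sumTo-cong : ∀ n {f g : ℕ → Carrier} → (∀ i → f i ≈ g i) → sumTo n f ≈ sumTo n g
  sumTo-cong n e = sumTo-cong-< n (λ i _ → e i)

  sumTo-vanishes : ∀ n {f : ℕ → Carrier} → (∀ i → i < n → f i ≈ 0#) → sumTo n f ≈ 0#
  sumTo-vanishes zero    e = refl
  sumTo-vanishes (suc n) e =
    trans (+-cong (sumTo-vanishes n (λ i i<n → e i (ℕP.m<n⇒m<1+n i<n))) (e n (ℕP.n<1+n n))) (+-identityˡ 0#)

  sumTo-distrib-+ : ∀ n (f g : ℕ → Carrier) → sumTo n (λ i → f i + g i) ≈ sumTo n f + sumTo n g
  sumTo-distrib-+ zero    f g = sym (+-identityˡ 0#)
  sumTo-distrib-+ (suc n) f g = begin
    sumTo n (λ i → f i + g i) + (f n + g n) ≈⟨ +-congʳ (sumTo-distrib-+ n f g) ⟩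
    (sumTo n f + sumTo n g) + (f n + g n)   ≈⟨ solve 4 (λ a b x y → (a :+ b) :+ (x :+ y) := (a :+ x) :+ (b :+ y))
                                                       refl (sumTo n f) (sumTo n g) (f n) (g n) ⟩
    (sumTo n f + f n) + (sumTo n g + g n)   ∎

  *-distribˡ-sumTo : ∀ n x (f : ℕ → Carrier) → x * sumTo n f ≈ sumTo n (λ i → x * f i)
  *-distribˡ-sumTo zero    x f = zeroʳ x
  *-distribˡ-sumTo (suc n) x f = trans (distribˡ x (sumTo n f) (f n)) (+-congʳ (*-distribˡ-sumTo n x f))

  *-distribʳ-sumTo : ∀ n x (f : ℕ → Carrier) → sumTo n f * x ≈ sumTo n (λ i → f i * x)
  *-distribʳ-sumTo zero    x f = zeroˡ x
  *-distribʳ-sumTo (suc n) x f = trans (distribʳ x (sumTo n f) (f n)) (+-congʳ (*-distribʳ-sumTo n x f))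

  sumTo-head : ∀ n (f : ℕ → Carrier) → sumTo (suc n) f ≈ f 0 + sumTo n (f ∘ suc)
  sumTo-head zero    f = trans (+-identityˡ (f 0)) (sym (+-identityʳ (f 0)))
  sumTo-head (suc n) f = trans (+-congʳ (sumTo-head n f)) (+-assoc _ _ _)

  sumTo-split : ∀ m n (f : ℕ → Carrier) → sumTo (m ℕ.+ n) f ≈ sumTo m f + sumTo n (λ i → f (m ℕ.+ i))
  sumTo-split m zero    f rewrite ℕP.+-identityʳ m = sym (+-identityʳ _)
  sumTo-split m (suc n) f rewrite ℕP.+-suc m n = trans (+-congʳ (sumTo-split m n f)) (+-assoc _ _ _)

  sumTo-swap : ∀ m n (g : ℕ → ℕ → Carrier) →
    sumTo m (λ i → sumTo n (g i)) ≈ sumTo n (λ j → sumTo m (λ i → g i j))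
  sumTo-swap zero    n g = sym (sumTo-vanishes n (λ _ _ → refl))
  sumTo-swap (suc m) n g = begin
    sumTo m (λ i → sumTo n (g i)) + sumTo n (g m)          ≈⟨ +-congʳ (sumTo-swap m n g) ⟩
    sumTo n (λ j → sumTo m (λ i → g i j)) + sumTo n (g m)  ≈⟨ sumTo-distrib-+ n _ _ ⟨
    sumTo n (λ j → sumTo m (λ i → g i j) + g m j)          ∎

  sumTo-single : ∀ n i (f : ℕ → Carrier) → i < n → (∀ k → k < n → k ≢ i → f k ≈ 0#) → sumTo n f ≈ f i
  sumTo-single (suc n) i f i<n others with i ℕP.≟ n
  ... | yes ≡.refl =
    trans (+-congʳ (sumTo-vanishes n (λ k k<n → others k (ℕP.m<n⇒m<1+n k<n) (ℕP.<⇒≢ k<n)))) (+-identityˡ _)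
  ... | no i≢n =
    trans (+-cong (sumTo-single n i f (ℕP.≤∧≢⇒< (ℕP.≤-pred i<n) i≢n) (λ k k<n → others k (ℕP.m<n⇒m<1+n k<n)))
                  (others n (ℕP.n<1+n n) (i≢n ∘ ≡.sym)))
          (+-identityʳ _)

  sumTo-extend : ∀ m n (f : ℕ → Carrier) → m ≤ n → (∀ i → m ≤ i → i < n → f i ≈ 0#) → sumTo n f ≈ sumTo m f
  sumTo-extend m n f m≤n tail with ℕP.m≤n⇒∃[o]m+o≡n m≤n
  ... | o , ≡.refl = trans (sumTo-split m o f)
    (trans (+-congˡ (sumTo-vanishes o (λ i i<o → tail (m ℕ.+ i) (ℕP.m≤m+n m i) (ℕP.+-monoʳ-< m i<o))))
           (+-identityʳ _))

  sumTo-reverse : ∀ n (f : ℕ → Carrier) → sumTo (suc n) f ≈ sumTo (suc n) (λ i → f (n ∸ i))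
  sumTo-reverse zero    f = refl
  sumTo-reverse (suc n) f = begin
    sumTo (suc n) f + f (suc n)                  ≈⟨ +-comm _ _ ⟩
    f (suc n) + sumTo (suc n) f                  ≈⟨ +-congˡ (sumTo-reverse n f) ⟩
    f (suc n) + sumTo (suc n) (λ i → f (n ∸ i))  ≈⟨ sumTo-head (suc n) (λ i → f (suc n ∸ i)) ⟨
    sumTo (suc (suc n)) (λ i → f (suc n ∸ i))    ∎

  sumTo-triangle : ∀ n (g : ℕ → ℕ → Carrier) →
    sumTo (suc n) (λ i → sumTo (suc i) (λ k → g k i)) ≈
    sumTo (suc n) (λ k → sumTo (suc (n ∸ k)) (λ m → g k (k ℕ.+ m)))
  sumTo-triangle zero    g = refl
  sumTo-triangle (suc n) g = begin
    sumTo (suc n) (λ i → sumTo (suc i) (λ k → g k i)) + (sumTo (suc n) (λ k → g k (suc n)) + g (suc n) (suc n))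
      ≈⟨ +-congʳ (sumTo-triangle n g) ⟩
    sumTo (suc n) inner + (sumTo (suc n) (λ k → g k (suc n)) + g (suc n) (suc n))
      ≈⟨ +-assoc _ _ _ ⟨
    (sumTo (suc n) inner + sumTo (suc n) (λ k → g k (suc n))) + g (suc n) (suc n)
      ≈⟨ +-congʳ (sumTo-distrib-+ (suc n) _ _) ⟨
    sumTo (suc n) (λ k → inner k + g k (suc n)) + g (suc n) (suc n)
      ≈⟨ +-cong (sumTo-cong-< (suc n) extendRow) lastRow ⟩
    sumTo (suc n) (λ k → sumTo (suc (suc n ∸ k)) (λ m → g k (k ℕ.+ m)))
      + sumTo (suc (suc n ∸ suc n)) (λ m → g (suc n) (suc n ℕ.+ m))
      ∎
    where
    inner : ℕ → Carrier
    inner k = sumTo (suc (n ∸ k)) (λ m → g k (k ℕ.+ m))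
    lastRow : g (suc n) (suc n) ≈ sumTo (suc (suc n ∸ suc n)) (λ m → g (suc n) (suc n ℕ.+ m))
    lastRow rewrite ℕP.n∸n≡0 n | ℕP.+-identityʳ n = sym (+-identityˡ _)
    extendRow : ∀ k → k < suc n → inner k + g k (suc n) ≈ sumTo (suc (suc n ∸ k)) (λ m → g k (k ℕ.+ m))
    extendRow k (s≤s k≤n) rewrite ℕP.+-∸-assoc 1 k≤n =
      +-congˡ (reflexive (≡.cong (g k) (≡.sym (≡.trans (ℕP.+-suc k (n ∸ k)) (≡.cong suc (ℕP.m+[n∸m]≡n k≤n))))))

  sumTo-blocks : ∀ Q M (f : ℕ → Carrier) → sumTo (Q ℕ.* M) f ≈ sumTo M (λ b → sumTo Q (λ r → f (Q ℕ.* b ℕ.+ r)))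
  sumTo-blocks Q zero    f rewrite ℕP.*-zeroʳ Q = refl
  sumTo-blocks Q (suc M) f rewrite ℕP.*-suc Q M | ℕP.+-comm Q (Q ℕ.* M) =
    trans (sumTo-split (Q ℕ.* M) Q f) (+-congʳ (sumTo-blocks Q M f))

module PowerSeries {c ℓ} (R : CommutativeRing c ℓ) where
  open Over R
  open FiniteSums R
  open import Relation.Binary.Reasoning.Setoid setoid

  infix 4 _≋_
  _≋_ : Series → Series → Set ℓ
  s ≋ t = ∀ n → s n ≈ t n

  _⊕_ : Series → Series → Series
  (s ⊕ t) n = s n + t n

  ⊝_ : Series → Series
  (⊝ s) n = - s n

  zeroS : Series
  zeroS n = 0#

  ⊛-cong : ∀ {s s′ t t′} → s ≋ s′ → t ≋ t′ → (s ⊛ t) ≋ (s′ ⊛ t′)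
  ⊛-cong e f n = sumTo-cong (suc n) (λ i → *-cong (e i) (f (n ∸ i)))

  ⊛-comm : ∀ s t → (s ⊛ t) ≋ (t ⊛ s)
  ⊛-comm s t n = begin
    sumTo (suc n) (λ i → s i * t (n ∸ i))              ≈⟨ sumTo-reverse n _ ⟩
    sumTo (suc n) (λ i → s (n ∸ i) * t (n ∸ (n ∸ i)))  ≈⟨ sumTo-cong-< (suc n) swapFactors ⟩
    sumTo (suc n) (λ i → t i * s (n ∸ i))              ∎
    where
    swapFactors : ∀ i → i < suc n → s (n ∸ i) * t (n ∸ (n ∸ i)) ≈ t i * s (n ∸ i)
    swapFactors i (s≤s i≤n) = trans (*-comm _ _) (*-congʳ (reflexive (≡.cong t (ℕP.m∸[m∸n]≡n i≤n))))

  ⊛-assoc : ∀ s t u → ((s ⊛ t) ⊛ u) ≋ (s ⊛ (t ⊛ u))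
  ⊛-assoc s t u n = begin
    sumTo (suc n) (λ i → sumTo (suc i) (λ k → s k * t (i ∸ k)) * u (n ∸ i))
      ≈⟨ sumTo-cong (suc n) (λ i → *-distribʳ-sumTo (suc i) _ _) ⟩
    sumTo (suc n) (λ i → sumTo (suc i) (λ k → s k * t (i ∸ k) * u (n ∸ i)))
      ≈⟨ sumTo-triangle n (λ k i → s k * t (i ∸ k) * u (n ∸ i)) ⟩
    sumTo (suc n) (λ k → sumTo (suc (n ∸ k)) (λ m → s k * t (k ℕ.+ m ∸ k) * u (n ∸ (k ℕ.+ m))))
      ≈⟨ sumTo-cong (suc n) (λ k → sumTo-cong (suc (n ∸ k)) (λ m → trans (*-assoc _ _ _) (*-congˡ (reindex k m)))) ⟩
    sumTo (suc n) (λ k → sumTo (suc (n ∸ k)) (λ m → s k * (t m * u (n ∸ k ∸ m))))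
      ≈⟨ sumTo-cong (suc n) (λ k → *-distribˡ-sumTo (suc (n ∸ k)) _ _) ⟨
    sumTo (suc n) (λ k → s k * sumTo (suc (n ∸ k)) (λ m → t m * u (n ∸ k ∸ m)))
      ∎
    where
    reindex : ∀ k m → t (k ℕ.+ m ∸ k) * u (n ∸ (k ℕ.+ m)) ≈ t m * u (n ∸ k ∸ m)
    reindex k m = reflexive (≡.cong₂ (λ i j → t i * u j) (ℕP.m+n∸m≡n k m) (≡.sym (ℕP.∸-+-assoc n k m)))

  ⊛-identityˡ : ∀ s → (oneS ⊛ s) ≋ s
  ⊛-identityˡ s n = begin
    sumTo (suc n) (λ i → oneS i * s (n ∸ i))       ≈⟨ sumTo-head n _ ⟩
    1# * s n + sumTo n (λ i → 0# * s (n ∸ suc i))  ≈⟨ +-cong (*-identityˡ _) (sumTo-vanishes n (λ i _ → zeroˡ _)) ⟩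
    s n + 0#                                       ≈⟨ +-identityʳ _ ⟩
    s n                                            ∎

  ⊛-distribˡ : ∀ s t u → (s ⊛ (t ⊕ u)) ≋ ((s ⊛ t) ⊕ (s ⊛ u))
  ⊛-distribˡ s t u n = trans (sumTo-cong (suc n) (λ i → distribˡ _ _ _)) (sumTo-distrib-+ (suc n) _ _)

  ⊛-distribʳ : ∀ s t u → ((t ⊕ u) ⊛ s) ≋ ((t ⊛ s) ⊕ (u ⊛ s))
  ⊛-distribʳ s t u n = trans (sumTo-cong (suc n) (λ i → distribʳ _ _ _)) (sumTo-distrib-+ (suc n) _ _)

  ⊛-isCommutativeRing : IsCommutativeRing _≋_ _⊕_ _⊛_ ⊝_ zeroS oneS
  ⊛-isCommutativeRing = record
    { isRing = record
      { +-isAbelianGroup = record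
        { isGroup = record
          { isMonoid = record
            { isSemigroup = record
              { isMagma = record
                { isEquivalence = record
                  { refl = λ n → refl ; sym = λ e n → sym (e n) ; trans = λ e f n → trans (e n) (f n) }
                ; ∙-cong = λ e f n → +-cong (e n) (f n) }
              ; assoc = λ s t u n → +-assoc _ _ _ }
            ; identity = (λ s n → +-identityˡ _) , (λ s n → +-identityʳ _) }
          ; inverse = (λ s n → -‿inverseˡ _) , (λ s n → -‿inverseʳ _)
          ; ⁻¹-cong = λ e n → -‿cong (e n) }
        ; comm = λ s t n → +-comm _ _ }
      ; *-cong = ⊛-cong
      ; *-assoc = ⊛-assoc
      ; *-identity = ⊛-identityˡ , (λ s n → trans (⊛-comm s oneS n) (⊛-identityˡ s n))
      ; distrib = ⊛-distribˡ , ⊛-distribʳ }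
    ; *-comm = ⊛-comm }

  seriesRing : CommutativeRing c ℓ
  seriesRing = record { isCommutativeRing = ⊛-isCommutativeRing }

  monomial : ℕ → Carrier → Series
  monomial zero    a zero    = a
  monomial zero    a (suc n) = 0#
  monomial (suc m) a zero    = 0#
  monomial (suc m) a (suc n) = monomial m a n

  shift : Series → Series
  shift s n = s (suc n)

  monomial-at : ∀ m a → monomial m a m ≡ a
  monomial-at zero    a = ≡.refl
  monomial-at (suc m) a = monomial-at m a

  monomial-off : ∀ m a i → i ≢ m → monomial m a i ≈ 0#
  monomial-off zero    a zero    i≢m = ⊥-elim (i≢m ≡.refl)
  monomial-off zero    a (suc i) i≢m = refl
  monomial-off (suc m) a zero    i≢m = refl
  monomial-off (suc m) a (suc i) i≢m = monomial-off m a i (i≢m ∘ ≡.cong suc)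

  monomial-cong : ∀ m {a b} → a ≈ b → monomial m a ≋ monomial m b
  monomial-cong zero    a≈b zero    = a≈b
  monomial-cong zero    a≈b (suc n) = refl
  monomial-cong (suc m) a≈b zero    = refl
  monomial-cong (suc m) a≈b (suc n) = monomial-cong m a≈b n

  monomial-+ : ∀ m u v → monomial m (u + v) ≋ (monomial m u ⊕ monomial m v)
  monomial-+ m u v i with i ℕP.≟ m
  ... | yes ≡.refl = reflexive (≡.trans (monomial-at i (u + v)) (≡.sym (≡.cong₂ _+_ (monomial-at i u) (monomial-at i v))))
  ... | no  i≢m    = trans (monomial-off m _ i i≢m) (sym (trans (+-cong (monomial-off m u i i≢m) (monomial-off m v i i≢m)) (+-identityˡ 0#)))

  monomial-sumTo : ∀ m n (f : ℕ → Carrier) i → sumTo n (λ k → monomial m (f k) i) ≈ monomial m (sumTo n f) i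
  monomial-sumTo m n f i with i ℕP.≟ m
  ... | yes ≡.refl = trans (sumTo-cong n (λ k → reflexive (monomial-at i (f k)))) (sym (reflexive (monomial-at i (sumTo n f))))
  ... | no  i≢m    = trans (sumTo-vanishes n (λ k _ → monomial-off m (f k) i i≢m)) (sym (monomial-off m (sumTo n f) i i≢m))

  monomial⊛-coeff : ∀ m a s n → (monomial m a ⊛ s) (m ℕ.+ n) ≈ a * s n
  monomial⊛-coeff m a s n = begin
    sumTo (suc (m ℕ.+ n)) (λ i → monomial m a i * s (m ℕ.+ n ∸ i))
      ≈⟨ sumTo-single (suc (m ℕ.+ n)) m _ (s≤s (ℕP.m≤m+n m n))
           (λ k _ k≢m → trans (*-congʳ (monomial-off m a k k≢m)) (zeroˡ _)) ⟩
    monomial m a m * s (m ℕ.+ n ∸ m)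
      ≡⟨ ≡.cong₂ _*_ (monomial-at m a) (≡.cong s (ℕP.m+n∸m≡n m n)) ⟩
    a * s n
      ∎

  monomial⊛-coeff-< : ∀ m a s N → N < m → (monomial m a ⊛ s) N ≈ 0#
  monomial⊛-coeff-< m a s N N<m = sumTo-vanishes (suc N) (λ i i<1+N →
    trans (*-congʳ (monomial-off m a i (ℕP.<⇒≢ (ℕP.<-≤-trans i<1+N N<m)))) (zeroˡ _))

  monomial⊛monomial : ∀ m k a b → (monomial m a ⊛ monomial k b) ≋ monomial (m ℕ.+ k) (a * b)
  monomial⊛monomial m k a b N with N ℕP.<? m
  ... | yes N<m = trans (monomial⊛-coeff-< m a (monomial k b) N N<m)
                        (sym (monomial-off (m ℕ.+ k) _ N (ℕP.<⇒≢ (ℕP.<-≤-trans N<m (ℕP.m≤m+n m k)))))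
  ... | no N≮m with ℕP.m≤n⇒∃[o]m+o≡n (ℕP.≮⇒≥ N≮m)
  ...   | n , ≡.refl = trans (monomial⊛-coeff m a (monomial k b) n) (scale n)
    where
    scale : ∀ n → a * monomial k b n ≈ monomial (m ℕ.+ k) (a * b) (m ℕ.+ n)
    scale n with n ℕP.≟ k
    ... | yes ≡.refl = reflexive (≡.trans (≡.cong (a *_) (monomial-at n b)) (≡.sym (monomial-at (m ℕ.+ n) (a * b))))
    ... | no n≢k = trans (*-congˡ (monomial-off k b n n≢k))
                         (trans (zeroʳ a) (sym (monomial-off (m ℕ.+ k) _ (m ℕ.+ n) (n≢k ∘ ℕP.+-cancelˡ-≡ m n k))))

  series-decompose : ∀ s → s ≋ (monomial 0 (s 0) ⊕ (monomial 1 1# ⊛ shift s))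
  series-decompose s zero    = sym (trans (+-congˡ (monomial⊛-coeff-< 1 1# (shift s) 0 (s≤s z≤n))) (+-identityʳ _))
  series-decompose s (suc n) = sym (trans (+-congˡ (monomial⊛-coeff 1 1# (shift s) n)) (trans (+-identityˡ _) (*-identityˡ _)))

  sumTo-coeff : ∀ n (g : ℕ → Series) m → Over.sumTo seriesRing n g m ≈ sumTo n (λ i → g i m)
  sumTo-coeff zero    g m = refl
  sumTo-coeff (suc n) g m = +-congʳ (sumTo-coeff n g m)

  section : ℕ → ℕ → Series → Series
  section Q j s m = s (Q ℕ.* m ℕ.+ j)

  -- t(x) = t′(x^Q)
  record Dilation (Q : ℕ) (t′ t : Series) : Set ℓ where
    field
      onMultiples  : ∀ m → t (Q ℕ.* m) ≈ t′ m
      offMultiples : ∀ m r → 0 < r → r < Q → t (Q ℕ.* m ℕ.+ r) ≈ 0#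

  section-dilation⊛ : ∀ {Q} → 0 < Q → ∀ {t′ t} → Dilation Q t′ t →
    ∀ s j → j < Q → section Q j (t ⊛ s) ≋ (t′ ⊛ section Q j s)
  section-dilation⊛ {Q} 0<Q {t′} {t} dil s j j<Q m = begin
    sumTo (suc N) f                                          ≈⟨ sumTo-extend (suc N) (Q ℕ.* suc m) f N<Q[1+m] beyondN ⟨
    sumTo (Q ℕ.* suc m) f                                    ≈⟨ sumTo-blocks Q (suc m) f ⟩
    sumTo (suc m) (λ b → sumTo Q (λ r → f (Q ℕ.* b ℕ.+ r)))  ≈⟨ sumTo-cong-< (suc m) block ⟩
    sumTo (suc m) (λ b → t′ b * s (Q ℕ.* (m ∸ b) ℕ.+ j))     ∎
    where
    open Dilation dil
    N = Q ℕ.* m ℕ.+ j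
    f = λ i → t i * s (N ∸ i)
    Q[1+m]≡Qm+Q : Q ℕ.* suc m ≡ Q ℕ.* m ℕ.+ Q
    Q[1+m]≡Qm+Q = ≡.trans (ℕP.*-suc Q m) (ℕP.+-comm Q (Q ℕ.* m))
    N<Q[1+m] : suc N ≤ Q ℕ.* suc m
    N<Q[1+m] = ℕP.≤-trans (ℕP.≤-reflexive (≡.sym (ℕP.+-suc (Q ℕ.* m) j)))
                 (ℕP.≤-trans (ℕP.+-monoʳ-≤ (Q ℕ.* m) j<Q) (ℕP.≤-reflexive (≡.sym Q[1+m]≡Qm+Q)))
    beyondN : ∀ i → suc N ≤ i → i < Q ℕ.* suc m → f i ≈ 0#
    beyondN i N<i i<Q[1+m] = trans (*-congʳ (trans (reflexive (≡.cong t (≡.sym i≡Qm+r))) (offMultiples m r 0<r r<Q))) (zeroˡ _)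
      where
      r = i ∸ Q ℕ.* m
      i≡Qm+r : Q ℕ.* m ℕ.+ r ≡ i
      i≡Qm+r = ℕP.m+[n∸m]≡n (ℕP.≤-trans (ℕP.m≤m+n (Q ℕ.* m) j) (ℕP.≤-trans (ℕP.n≤1+n N) N<i))
      0<r : 0 < r
      0<r = ℕP.m<n⇒0<n∸m (ℕP.≤-trans (s≤s (ℕP.m≤m+n (Q ℕ.* m) j)) N<i)
      r<Q : r < Q
      r<Q = ℕP.+-cancelˡ-< (Q ℕ.* m) r Q
              (ℕP.<-≤-trans (ℕP.≤-<-trans (ℕP.≤-reflexive i≡Qm+r) i<Q[1+m]) (ℕP.≤-reflexive Q[1+m]≡Qm+Q))
    block : ∀ b → b < suc m → sumTo Q (λ r → f (Q ℕ.* b ℕ.+ r)) ≈ t′ b * s (Q ℕ.* (m ∸ b) ℕ.+ j)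
    block b (s≤s b≤m) = begin
      sumTo Q (λ r → f (Q ℕ.* b ℕ.+ r))
        ≈⟨ sumTo-single Q 0 _ 0<Q (λ r r<Q r≢0 → trans (*-congʳ (offMultiples b r (ℕP.n≢0⇒n>0 r≢0) r<Q)) (zeroˡ _)) ⟩
      f (Q ℕ.* b ℕ.+ 0)                 ≡⟨ ≡.cong f (ℕP.+-identityʳ (Q ℕ.* b)) ⟩
      t (Q ℕ.* b) * s (N ∸ Q ℕ.* b)     ≈⟨ *-cong (onMultiples b) (reflexive (≡.cong s index)) ⟩
      t′ b * s (Q ℕ.* (m ∸ b) ℕ.+ j)    ∎
      where
      index : Q ℕ.* m ℕ.+ j ∸ Q ℕ.* b ≡ Q ℕ.* (m ∸ b) ℕ.+ j
      index = ≡.trans (ℕP.+-∸-comm j (ℕP.*-monoʳ-≤ Q b≤m)) (≡.cong (ℕ._+ j) (≡.sym (ℕP.*-distribˡ-∸ Q m b)))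

  -- inverseUpTo k is correct in degrees ≤ k; the fuel only makes the recursion structural.
  module _ (s : Series) (u : Carrier) (s₀u≈1 : s 0 * u ≈ 1#) where
    private
      inverseUpTo : ℕ → Series
      inverseUpTo k       zero    = u
      inverseUpTo zero    (suc n) = 0#
      inverseUpTo (suc k) (suc n) = - (u * sumTo (suc n) (λ i → s (suc i) * inverseUpTo k (n ∸ i)))

      inverseUpTo-stable : ∀ k l n → n ≤ k → n ≤ l → inverseUpTo k n ≈ inverseUpTo l n
      inverseUpTo-stable k       l       zero    _         _         = refl
      inverseUpTo-stable (suc k) (suc l) (suc n) (s≤s n≤k) (s≤s n≤l) =
        -‿cong (*-congˡ (sumTo-cong (suc n) (λ i → *-congˡ
          (inverseUpTo-stable k l (n ∸ i) (ℕP.≤-trans (ℕP.m∸n≤m n i) n≤k) (ℕP.≤-trans (ℕP.m∸n≤m n i) n≤l)))))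

      inverse : Series
      inverse n = inverseUpTo n n

      ⊛-inverse : (s ⊛ inverse) ≋ oneS
      ⊛-inverse zero    = trans (+-identityˡ _) s₀u≈1
      ⊛-inverse (suc n) = begin
        sumTo (suc (suc n)) (λ i → s i * inverse (suc n ∸ i))  ≈⟨ sumTo-head (suc n) _ ⟩
        s 0 * inverse (suc n) + S                            ≈⟨ +-congʳ (*-congˡ (-‿cong (*-congˡ (sumTo-cong (suc n) stable)))) ⟩
        s 0 * (- (u * S)) + S                                ≈⟨ +-congʳ (-‿distribʳ-* (s 0) (u * S)) ⟨
        - (s 0 * (u * S)) + S                                ≈⟨ +-congʳ (-‿cong (trans (sym (*-assoc _ _ _)) (trans (*-congʳ s₀u≈1) (*-identityˡ S)))) ⟩
        - S + S                                              ≈⟨ -‿inverseˡ S ⟩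
        0#                                                   ∎
        where
        open import Algebra.Properties.Ring ring using (-‿distribʳ-*)
        S = sumTo (suc n) (λ i → s (suc i) * inverse (n ∸ i))
        stable : ∀ i → s (suc i) * inverseUpTo n (n ∸ i) ≈ s (suc i) * inverse (n ∸ i)
        stable i = *-congˡ (inverseUpTo-stable n (n ∸ i) (n ∸ i) (ℕP.m∸n≤m n i) ℕP.≤-refl)

    unit-invertible : ∃[ t ] ((s ⊛ t) ≋ oneS)
    unit-invertible = inverse , ⊛-inverse

  open Exp semiring using (_^_)
  open Mult semiring using (_×_)
  module SeriesExp = Exp (CommutativeRing.semiring seriesRing)
  private
    module SeriesMult = Mult (CommutativeRing.semiring seriesRing)
    open import Algebra.Properties.CommutativeSemiring.Exp (CommutativeRing.commutativeSemiring seriesRing)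
      using () renaming (^-distrib-* to ⊛-^-distrib)

  infixr 8 _^ˢ_
  _^ˢ_ : Series → ℕ → Series
  _^ˢ_ = SeriesExp._^_

  powS≋^ˢ : ∀ s n → powS s n ≋ s ^ˢ n
  powS≋^ˢ s zero    k = refl
  powS≋^ˢ s (suc n) = ⊛-cong {s} {s} (λ _ → refl) (powS≋^ˢ s n)

  monomial-^ˢ : ∀ m a n → (monomial m a ^ˢ n) ≋ monomial (n ℕ.* m) (a ^ n)
  monomial-^ˢ m a zero    zero    = refl
  monomial-^ˢ m a zero    (suc k) = refl
  monomial-^ˢ m a (suc n) k =
    trans (⊛-cong {monomial m a} (λ _ → refl) (monomial-^ˢ m a n) k) (monomial⊛monomial m (n ℕ.* m) a (a ^ n) k)

  seriesRing-characteristic : ∀ p → (∀ x → p × x ≈ 0#) → ∀ s → (p SeriesMult.× s) ≋ zeroS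
  seriesRing-characteristic p charP s m = trans (×-coeff p) (charP (s m))
    where
    ×-coeff : ∀ n → (n SeriesMult.× s) m ≈ n × s m
    ×-coeff zero    = refl
    ×-coeff (suc n) = +-congˡ (×-coeff n)

  -- Writing s = s 0 + x · shift s, additivity gives s ^ Q = (s 0) ^ Q + x ^ Q · (shift s) ^ Q; iterate.
  module _ {Q} (0<Q : 0 < Q) (^Q-additive : ∀ u v → ((u ⊕ v) ^ˢ Q) ≋ ((u ^ˢ Q) ⊕ (v ^ˢ Q))) where
    private
      ^Q-decompose : ∀ s → (s ^ˢ Q) ≋ (monomial 0 (s 0 ^ Q) ⊕ (monomial Q 1# ⊛ (shift s ^ˢ Q)))
      ^Q-decompose s N = begin
        (s ^ˢ Q) N
          ≈⟨ SeriesExp.^-congˡ Q {s} {monomial 0 (s 0) ⊕ x⊛s′} (series-decompose s) N ⟩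
        ((monomial 0 (s 0) ⊕ x⊛s′) ^ˢ Q) N
          ≈⟨ ^Q-additive (monomial 0 (s 0)) x⊛s′ N ⟩
        (monomial 0 (s 0) ^ˢ Q) N + (x⊛s′ ^ˢ Q) N
          ≈⟨ +-cong (monomial-^ˢ 0 (s 0) Q N) (⊛-^-distrib (monomial 1 1#) (shift s) Q N) ⟩
        monomial (Q ℕ.* 0) (s 0 ^ Q) N + ((monomial 1 1# ^ˢ Q) ⊛ (shift s ^ˢ Q)) N
          ≈⟨ +-cong (reflexive (≡.cong (λ k → monomial k (s 0 ^ Q) N) (ℕP.*-zeroʳ Q)))
                    (⊛-cong {monomial 1 1# ^ˢ Q} {_} {shift s ^ˢ Q} (λ k → trans (monomial-^ˢ 1 1# Q k) (xQ k)) (λ _ → refl) N) ⟩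
        monomial 0 (s 0 ^ Q) N + (monomial Q 1# ⊛ (shift s ^ˢ Q)) N
          ∎
        where
        x⊛s′ = monomial 1 1# ⊛ shift s
        xQ : monomial (Q ℕ.* 1) (1# ^ Q) ≋ monomial Q 1#
        xQ k rewrite ℕP.*-identityʳ Q = monomial-cong Q (1#-^ Q) k
          where
          1#-^ : ∀ n → 1# ^ n ≈ 1#
          1#-^ zero    = refl
          1#-^ (suc n) = trans (*-identityˡ _) (1#-^ n)

      Q+n≢0 : ∀ n → Q ℕ.+ n ≢ 0
      Q+n≢0 n = ℕP.>⇒≢ (ℕP.<-≤-trans 0<Q (ℕP.m≤m+n Q n))

      onMultiples : ∀ m s → (s ^ˢ Q) (Q ℕ.* m) ≈ s m ^ Q
      onMultiples zero s rewrite ℕP.*-zeroʳ Q =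
        trans (^Q-decompose s 0) (trans (+-congˡ (monomial⊛-coeff-< Q 1# (shift s ^ˢ Q) 0 0<Q)) (+-identityʳ _))
      onMultiples (suc m) s rewrite ℕP.*-suc Q m =
        trans (^Q-decompose s _)
          (trans (+-cong (monomial-off 0 _ _ (Q+n≢0 _)) (monomial⊛-coeff Q 1# (shift s ^ˢ Q) (Q ℕ.* m)))
            (trans (+-identityˡ _) (trans (*-identityˡ _) (onMultiples m (shift s)))))

      offMultiples : ∀ m s r → 0 < r → r < Q → (s ^ˢ Q) (Q ℕ.* m ℕ.+ r) ≈ 0#
      offMultiples zero s r 0<r r<Q rewrite ℕP.*-zeroʳ Q =
        trans (^Q-decompose s r)
          (trans (+-cong (monomial-off 0 _ r (ℕP.>⇒≢ 0<r)) (monomial⊛-coeff-< Q 1# (shift s ^ˢ Q) r r<Q)) (+-identityˡ 0#))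
      offMultiples (suc m) s r 0<r r<Q rewrite ℕP.*-suc Q m | ℕP.+-assoc Q (Q ℕ.* m) r =
        trans (^Q-decompose s _)
          (trans (+-cong (monomial-off 0 _ _ (Q+n≢0 _)) (monomial⊛-coeff Q 1# (shift s ^ˢ Q) (Q ℕ.* m ℕ.+ r)))
            (trans (+-identityˡ _) (trans (*-identityˡ _) (offMultiples m (shift s) r 0<r r<Q))))

    ^ˢ-dilation : ∀ s → Dilation Q (λ m → s m ^ Q) (s ^ˢ Q)
    ^ˢ-dilation s = record { onMultiples = λ m → onMultiples m s ; offMultiples = λ m → offMultiples m s }

module PrimeCharacteristic where
  open import Data.Nat using (_!)
  open import Data.Nat.Divisibility using (_∣_; divides; ∣1⇒≡1; ∣⇒≤; m∣m*n; m∣n⇒n≡quotient*m; n/m≡quotient)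
  open import Data.Nat.Primality using (prime⇒nonTrivial; euclidsLemma)
  open import Data.Nat.Combinatorics using (_C_; nCn≡1; k![n∸k]!∣n!)
  open import Data.Nat.Combinatorics.Specification using (nCk≡n!/k![n-k]!)
  open import Data.Fin as Fin using (Fin; toℕ; fromℕ; inject₁)
  import Data.Fin.Properties as FinP

  module _ {p : ℕ} (p-prime : Prime p) where
    prime>1 : 1 < p
    prime>1 = ℕ.nonTrivial⇒n>1 p
      where instance _ = prime⇒nonTrivial p-prime

    prime∤! : ∀ m → m < p → ¬ (p ∣ m !)
    prime∤! zero    m<p p∣1 = ℕP.<-irrefl (≡.sym (∣1⇒≡1 p∣1)) prime>1
    prime∤! (suc m) m<p p∣[1+m]! with euclidsLemma (suc m) (m !) p-prime p∣[1+m]!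
    ... | inj₁ p∣1+m = ℕP.<⇒≱ m<p (∣⇒≤ p∣1+m)
    ... | inj₂ p∣m!  = prime∤! m (ℕP.<-trans (ℕP.n<1+n m) m<p) p∣m!

    prime∣choose : ∀ k → 0 < k → k < p → p ∣ (p C k)
    prime∣choose k 0<k k<p with euclidsLemma (p C k) (k ! ℕ.* (p ∸ k) !) p-prime p∣product
      where
      instance _ = k ℕP.!* (p ∸ k) !≢0
      p!≡ : p ! ≡ (p C k) ℕ.* (k ! ℕ.* (p ∸ k) !)
      p!≡ = ≡.trans (m∣n⇒n≡quotient*m (k![n∸k]!∣n! (ℕP.<⇒≤ k<p)))
              (≡.cong (ℕ._* (k ! ℕ.* (p ∸ k) !))
                (≡.trans (≡.sym (n/m≡quotient (k![n∸k]!∣n! (ℕP.<⇒≤ k<p)))) (≡.sym (nCk≡n!/k![n-k]! (ℕP.<⇒≤ k<p)))))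
      p∣p! : p ∣ p !
      p∣p! = n∣n! (ℕP.<-trans (s≤s z≤n) prime>1)
        where
        n∣n! : ∀ {n} → 0 < n → n ∣ n !
        n∣n! {suc n} _ = m∣m*n (n !)
      p∣product : p ∣ (p C k) ℕ.* (k ! ℕ.* (p ∸ k) !)
      p∣product = ≡.subst (p ∣_) p!≡ p∣p!
    ... | inj₁ p∣pCk = p∣pCk
    ... | inj₂ p∣k![p∸k]! with euclidsLemma (k !) ((p ∸ k) !) p-prime p∣k![p∸k]!
    ...   | inj₁ p∣k!     = ⊥-elim (prime∤! k k<p p∣k!)
    ...   | inj₂ p∣[p∸k]! = ⊥-elim (prime∤! (p ∸ k) (ℕP.∸-monoʳ-< 0<k (ℕP.<⇒≤ k<p)) p∣[p∸k]!)

  module _ {c ℓ} (R : CommutativeRing c ℓ) {p : ℕ} (p-prime : Prime p) where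
    open CommutativeRing R hiding (zero)
    open Mult semiring
    open Exp semiring
    open import Algebra.Properties.Monoid.Sum +-monoid using (sum; sum-init-last)
    import Algebra.Properties.CommutativeSemiring.Binomial commutativeSemiring as Binomial
    open import Relation.Binary.Reasoning.Setoid setoid

    module _ (charP : p × 1# ≈ 0#) where
      characteristic : ∀ x → p × x ≈ 0#
      characteristic x = trans (sym (trans (×-assoc-* p 1# x) (×-congʳ p (*-identityˡ x)))) (trans (*-congʳ charP) (zeroˡ x))

      private
        sum-endpoints : ∀ n (t : Fin (suc (suc n)) → Carrier) → (∀ i → t (Fin.suc (inject₁ i)) ≈ 0#) →
                        sum t ≈ t Fin.zero + t (fromℕ (suc n))
        sum-endpoints n t inner≈0 = +-congˡ (begin
          sum (t ∘ Fin.suc)                                    ≈⟨ sum-init-last (t ∘ Fin.suc) ⟩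
          sum (λ i → t (Fin.suc (inject₁ i))) + t (fromℕ (suc n)) ≈⟨ +-congʳ (sum-vanishes n _ inner≈0) ⟩
          0# + t (fromℕ (suc n))                                ≈⟨ +-identityˡ _ ⟩
          t (fromℕ (suc n))                                     ∎)
          where
          sum-vanishes : ∀ m (f : Fin m → Carrier) → (∀ i → f i ≈ 0#) → sum f ≈ 0#
          sum-vanishes zero    f f≈0 = refl
          sum-vanishes (suc m) f f≈0 = trans (+-cong (f≈0 Fin.zero) (sum-vanishes m (f ∘ Fin.suc) (f≈0 ∘ Fin.suc))) (+-identityˡ 0#)

        freshman : ∀ N → 1 < N → (∀ k → 0 < k → k < N → N ∣ (N C k)) → (∀ x → N × x ≈ 0#) →
                   ∀ u v → (u + v) ^ N ≈ u ^ N + v ^ N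
        freshman (suc zero)    (s≤s ())
        freshman (suc (suc n)) _ N∣choose charN u v = begin
          (u + v) ^ N                                   ≈⟨ Binomial.theorem N u v ⟩
          sum (Binomial.binomialTerm u v N)            ≈⟨ sum-endpoints (suc n) (Binomial.binomialTerm u v N) innerTerm ⟩
          Binomial.binomialTerm u v N Fin.zero + Binomial.binomialTerm u v N (fromℕ N)
                                                        ≈⟨ +-cong (trans (+-identityʳ _) (*-identityˡ _)) (lastTerm (toℕ (fromℕ N)) (FinP.toℕ-fromℕ N)) ⟩
          v ^ N + u ^ N                                 ≈⟨ +-comm _ _ ⟩
          u ^ N + v ^ N                                 ∎
          where
          N = suc (suc n)
          innerTerm : ∀ i → Binomial.binomialTerm u v N (Fin.suc (inject₁ i)) ≈ 0#
          innerTerm i with N∣choose (suc (toℕ (inject₁ i))) (s≤s z≤n)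
                                    (s≤s (ℕP.≤-<-trans (ℕP.≤-reflexive (FinP.toℕ-inject₁ i)) (FinP.toℕ<n i)))
          ... | divides m NCk≡m*N = begin
            (N C suc (toℕ (inject₁ i))) × B ≡⟨ ≡.cong (_× B) NCk≡m*N ⟩
            (m ℕ.* N) × B                   ≈⟨ ×-congˡ (ℕP.*-comm m N) ⟩
            (N ℕ.* m) × B                   ≈⟨ ×-assocˡ B N m ⟨
            N × (m × B)                     ≈⟨ charN _ ⟩
            0#                              ∎
            where B = Binomial.binomial u v N (Fin.suc (inject₁ i))
          lastTerm : ∀ k → k ≡ N → (N C k) × (u ^ k * v ^ (N ∸ k)) ≈ u ^ N
          lastTerm k ≡.refl = begin
            (N C N) × (u ^ N * v ^ (N ∸ N)) ≈⟨ ×-congˡ (nCn≡1 N) ⟩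
            1 × (u ^ N * v ^ (N ∸ N))       ≈⟨ +-identityʳ _ ⟩
            u ^ N * v ^ (N ∸ N)             ≈⟨ *-congˡ (^-congʳ v (ℕP.n∸n≡0 N)) ⟩
            u ^ N * 1#                      ≈⟨ *-identityʳ _ ⟩
            u ^ N                           ∎

      frobenius-+ : ∀ u v → (u + v) ^ p ≈ u ^ p + v ^ p
      frobenius-+ = freshman p (prime>1 p-prime) (prime∣choose p-prime) characteristic

      frobenius^-+ : ∀ k u v → (u + v) ^ (p ℕ.^ k) ≈ u ^ (p ℕ.^ k) + v ^ (p ℕ.^ k)
      frobenius^-+ zero    u v = trans (*-identityʳ _) (+-cong (sym (*-identityʳ u)) (sym (*-identityʳ v)))
      frobenius^-+ (suc k) u v = begin
        (u + v) ^ (p ℕ.* p ℕ.^ k)                  ≈⟨ ^-assocʳ (u + v) p (p ℕ.^ k) ⟨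
        ((u + v) ^ p) ^ (p ℕ.^ k)                  ≈⟨ ^-congˡ (p ℕ.^ k) (frobenius-+ u v) ⟩
        (u ^ p + v ^ p) ^ (p ℕ.^ k)                ≈⟨ frobenius^-+ k _ _ ⟩
        (u ^ p) ^ (p ℕ.^ k) + (v ^ p) ^ (p ℕ.^ k)  ≈⟨ +-cong (^-assocʳ u p (p ℕ.^ k)) (^-assocʳ v p (p ℕ.^ k)) ⟩
        u ^ (p ℕ.* p ℕ.^ k) + v ^ (p ℕ.* p ℕ.^ k)  ∎

module FiniteField {c ℓ} (F : CommutativeRing c ℓ) (q : ℕ) (isFiniteField : IsFiniteField F q) where
  open CommutativeRing F hiding (zero)
  open IsFiniteField isFiniteField
  open Mult semiring
  open Exp semiring
  open import Data.Fin as Fin using (Fin; punchIn)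
  open import Data.Fin.Properties using (punchInᵢ≢i)
  open import Data.Fin.Permutation using (Permutation′; permutation)
  open import Data.Vec.Functional using (replicate; removeAt)
  import Algebra.Properties.CommutativeMonoid.Sum as CommutativeMonoidSum
  import Algebra.Properties.Monoid.Sum as MonoidSum
  open import Algebra.Properties.AbelianGroup +-abelianGroup using (identityˡ-unique)
  open import Relation.Binary.Reasoning.Setoid setoid

  index : Carrier → Fin q
  index x = proj₁ (enum-surj x)

  enum-index : ∀ x → enum (index x) ≈ x
  enum-index x = proj₂ (enum-surj x)

  index-cong : ∀ {x y} → x ≈ y → index x ≡ index y
  index-cong {x} {y} x≈y = enum-inj _ _ (trans (enum-index x) (trans x≈y (sym (enum-index y))))

  index-enum : ∀ i → index (enum i) ≡ i
  index-enum i = enum-inj _ _ (enum-index (enum i))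

  _≈0? : ∀ x → Dec (x ≈ 0#)
  x ≈0? with index x Fin.≟ index 0#
  ... | yes eq  = yes (trans (sym (enum-index x)) (trans (reflexive (≡.cong enum eq)) (enum-index 0#)))
  ... | no  neq = no (neq ∘ index-cong)

  q>1 : 1 < q
  q>1 = distinct⇒>1 (index 0#) (index 1#) index0≢index1
    where
    distinct⇒>1 : ∀ {n} (i j : Fin n) → i ≢ j → 1 < n
    distinct⇒>1 {suc zero}    Fin.zero Fin.zero i≢j = ⊥-elim (i≢j ≡.refl)
    distinct⇒>1 {suc (suc n)} _        _        _   = s≤s (s≤s z≤n)
    index0≢index1 : index 0# ≢ index 1#
    index0≢index1 eq = 1≉0 (trans (sym (enum-index 1#)) (trans (reflexive (≡.cong enum (≡.sym eq))) (enum-index 0#)))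

  q>0 : 0 < q
  q>0 = ℕP.<-trans (s≤s z≤n) q>1

  permute : (g g⁻¹ : Carrier → Carrier) → (∀ {x y} → x ≈ y → g x ≈ g y) → (∀ {x y} → x ≈ y → g⁻¹ x ≈ g⁻¹ y) →
            (∀ y → g (g⁻¹ y) ≈ y) → (∀ y → g⁻¹ (g y) ≈ y) → Permutation′ q
  permute g g⁻¹ g-cong g⁻¹-cong gg⁻¹ g⁻¹g = permutation (λ i → index (g (enum i))) (λ i → index (g⁻¹ (enum i)))
    (λ i → ≡.trans (index-cong (trans (g-cong (enum-index _)) (gg⁻¹ (enum i)))) (index-enum i))
    (λ i → ≡.trans (index-cong (trans (g⁻¹-cong (enum-index _)) (g⁻¹g (enum i)))) (index-enum i))

  *-nonzero : ∀ {a b} → ¬ a ≈ 0# → ¬ b ≈ 0# → ¬ (a * b ≈ 0#)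
  *-nonzero {a} {b} a≉0 b≉0 ab≈0 with inverse a a≉0
  ... | a⁻¹ , aa⁻¹≈1 = b≉0 (begin
    b              ≈⟨ *-identityˡ b ⟨
    1# * b         ≈⟨ *-congʳ (trans (sym aa⁻¹≈1) (*-comm a a⁻¹)) ⟩
    (a⁻¹ * a) * b  ≈⟨ *-assoc a⁻¹ a b ⟩
    a⁻¹ * (a * b)  ≈⟨ *-congˡ ab≈0 ⟩
    a⁻¹ * 0#       ≈⟨ zeroʳ a⁻¹ ⟩
    0#             ∎)

  ^-nonzero : ∀ {a} → ¬ a ≈ 0# → ∀ k → ¬ (a ^ k ≈ 0#)
  ^-nonzero a≉0 zero    = 1≉0
  ^-nonzero a≉0 (suc k) = *-nonzero a≉0 (^-nonzero a≉0 k)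

  private
    module Additive = MonoidSum +-monoid
    module Multiplicative = MonoidSum *-monoid

  -- Translation by 1 permutes F, so the sum of all elements S satisfies S = S + q × 1.
  q×1≈0 : q × 1# ≈ 0#
  q×1≈0 = identityˡ-unique (q × 1#) S (sym (begin
    S                                              ≈⟨ sum-permute enum translate ⟩
    Additive.sum (λ i → enum (index (enum i + 1#))) ≈⟨ Additive.sum-cong-≋ {q} (λ i → enum-index (enum i + 1#)) ⟩
    Additive.sum (λ i → enum i + 1#)               ≈⟨ ∑-distrib-+ enum (λ _ → 1#) ⟩
    S + Additive.sum (replicate q 1#)              ≈⟨ +-congˡ (Additive.sum-replicate q) ⟩
    S + q × 1#                                     ≈⟨ +-comm _ _ ⟩
    q × 1# + S                                     ∎))
    where
    open CommutativeMonoidSum +-commutativeMonoid using (sum-permute; ∑-distrib-+)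
    S = Additive.sum enum
    translate = permute (_+ 1#) (_- 1#) +-congʳ +-congʳ
      (λ y → trans (+-assoc _ _ _) (trans (+-congˡ (-‿inverseˡ 1#)) (+-identityʳ y)))
      (λ y → trans (+-assoc _ _ _) (trans (+-congˡ (-‿inverseʳ 1#)) (+-identityʳ y)))

  characteristic : ∀ {p k} → 0 < k → q ≡ p ℕ.^ k → p × 1# ≈ 0#
  characteristic {p} {k} 0<k q≡p^k with (p × 1#) ≈0?
  ... | yes p≈0 = p≈0
  ... | no  p≉0 = ⊥-elim (^-nonzero p≉0 k (trans (sym (^×1 k)) (trans (×-congˡ (≡.sym q≡p^k)) q×1≈0)))
    where
    ^×1 : ∀ k → (p ℕ.^ k) × 1# ≈ (p × 1#) ^ k
    ^×1 zero    = +-identityʳ 1#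
    ^×1 (suc k) = trans (×1-homo-* p (p ℕ.^ k)) (*-congˡ (^×1 k))

  private
    open CommutativeMonoidSum *-commutativeMonoid using (sum-permute; ∑-distrib-+; sum-remove)

    nonzeroPart : Carrier → Carrier
    nonzeroPart y with y ≈0?
    ... | yes _ = 1#
    ... | no  _ = y

    nonzeroPart-cong : ∀ {y z} → y ≈ z → nonzeroPart y ≈ nonzeroPart z
    nonzeroPart-cong {y} {z} y≈z with y ≈0? | z ≈0?
    ... | yes _   | yes _   = refl
    ... | yes y≈0 | no  z≉0 = ⊥-elim (z≉0 (trans (sym y≈z) y≈0))
    ... | no  y≉0 | yes z≈0 = ⊥-elim (y≉0 (trans y≈z z≈0))
    ... | no  _   | no  _   = y≈z

    D : Carrier
    D = Multiplicative.sum (nonzeroPart ∘ enum)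

    D≉0 : ¬ D ≈ 0#
    D≉0 = product≉0 q (nonzeroPart ∘ enum) (nonzeroPart≉0 ∘ enum)
      where
      nonzeroPart≉0 : ∀ y → ¬ nonzeroPart y ≈ 0#
      nonzeroPart≉0 y with y ≈0?
      ... | yes _   = 1≉0
      ... | no  y≉0 = y≉0
      product≉0 : ∀ n (t : Fin n → Carrier) → (∀ i → ¬ t i ≈ 0#) → ¬ Multiplicative.sum t ≈ 0#
      product≉0 zero    t t≉0 = 1≉0
      product≉0 (suc n) t t≉0 = *-nonzero (t≉0 Fin.zero) (product≉0 n (t ∘ Fin.suc) (t≉0 ∘ Fin.suc))

    product-except-one : ∀ {n} x (t : Fin n → Carrier) (j₀ : Fin n) → t j₀ ≈ 1# → (∀ j → j ≢ j₀ → t j ≈ x) →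
                         Multiplicative.sum t * x ≈ x ^ n
    product-except-one {suc n} x t j₀ t₀≈1 t≈x = begin
      Multiplicative.sum t * x                          ≈⟨ *-congʳ (sum-remove {i = j₀} t) ⟩
      (t j₀ * Multiplicative.sum (removeAt t j₀)) * x    ≈⟨ *-congʳ (*-cong t₀≈1 (Multiplicative.sum-cong-≋
                                                             (λ j → t≈x (punchIn j₀ j) (punchInᵢ≢i j₀ j)))) ⟩
      (1# * Multiplicative.sum (replicate n x)) * x      ≈⟨ *-congʳ (trans (*-identityˡ _) (Multiplicative.sum-replicate n)) ⟩
      x ^ n * x                                          ≈⟨ *-comm _ _ ⟩
      x * x ^ n                                          ∎

    -- Multiplication by x permutes F; comparing the products of nonzeroPart over F before and after
    -- gives D = x^(q−1) · D.
    module _ {x} (x≉0 : ¬ x ≈ 0#) where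
      scale : Fin q → Carrier
      scale i with enum i ≈0?
      ... | yes _ = 1#
      ... | no  _ = x

      nonzeroPart-* : ∀ i → nonzeroPart (x * enum i) ≈ scale i * nonzeroPart (enum i)
      nonzeroPart-* i with enum i ≈0? | (x * enum i) ≈0?
      ... | yes _   | yes _    = sym (*-identityˡ 1#)
      ... | yes e≈0 | no  xe≉0 = ⊥-elim (xe≉0 (trans (*-congˡ e≈0) (zeroʳ x)))
      ... | no  e≉0 | yes xe≈0 = ⊥-elim (*-nonzero x≉0 e≉0 xe≈0)
      ... | no  _   | no  _    = refl

      product-scale : Multiplicative.sum scale * x ≈ x ^ q
      product-scale = product-except-one x scale (index 0#) scale-at-0 scale-off-0
        where
        scale-at-0 : scale (index 0#) ≈ 1#
        scale-at-0 with enum (index 0#) ≈0?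
        ... | yes _   = refl
        ... | no  e≉0 = ⊥-elim (e≉0 (enum-index 0#))
        scale-off-0 : ∀ j → j ≢ index 0# → scale j ≈ x
        scale-off-0 j j≢ with enum j ≈0?
        ... | yes e≈0 = ⊥-elim (j≢ (enum-inj j (index 0#) (trans e≈0 (sym (enum-index 0#)))))
        ... | no  _   = refl

      D≈scale*D : D ≈ Multiplicative.sum scale * D
      D≈scale*D with inverse x x≉0
      ... | x⁻¹ , xx⁻¹≈1 = begin
        D                                                                  ≈⟨ sum-permute (nonzeroPart ∘ enum) multiply ⟩
        Multiplicative.sum (λ i → nonzeroPart (enum (index (x * enum i))))  ≈⟨ Multiplicative.sum-cong-≋ {q}
                                                                           (λ i → trans (nonzeroPart-cong (enum-index _)) (nonzeroPart-* i)) ⟩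
        Multiplicative.sum (λ i → scale i * nonzeroPart (enum i))          ≈⟨ ∑-distrib-+ scale (nonzeroPart ∘ enum) ⟩
        Multiplicative.sum scale * D                                       ∎
        where
        multiply = permute (x *_) (x⁻¹ *_) *-congˡ *-congˡ
          (λ y → trans (sym (*-assoc _ _ _)) (trans (*-congʳ xx⁻¹≈1) (*-identityˡ y)))
          (λ y → trans (sym (*-assoc _ _ _)) (trans (*-congʳ (trans (*-comm x⁻¹ x) xx⁻¹≈1)) (*-identityˡ y)))

      D·x≈D·x^q : D * x ≈ D * x ^ q
      D·x≈D·x^q = begin
        D * x                              ≈⟨ *-congʳ D≈scale*D ⟩
        (Multiplicative.sum scale * D) * x ≈⟨ trans (*-assoc _ _ _) (trans (*-congˡ (*-comm D x)) (sym (*-assoc _ _ _))) ⟩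
        (Multiplicative.sum scale * x) * D ≈⟨ *-congʳ product-scale ⟩
        x ^ q * D                          ≈⟨ *-comm _ _ ⟩
        D * x ^ q                          ∎

  fermat : ∀ x → x ^ q ≈ x
  fermat x with x ≈0?
  ... | yes x≈0 = trans (^-vanishes q q>0) (sym x≈0)
    where
    ^-vanishes : ∀ k → 0 < k → x ^ k ≈ 0#
    ^-vanishes (suc k) _ = trans (*-congʳ x≈0) (zeroˡ _)
  ... | no x≉0 with inverse D D≉0
  ...   | D⁻¹ , DD⁻¹≈1 = begin
    x ^ q               ≈⟨ cancel (x ^ q) ⟨
    D⁻¹ * (D * x ^ q)   ≈⟨ *-congˡ (D·x≈D·x^q x≉0) ⟨
    D⁻¹ * (D * x)       ≈⟨ cancel x ⟩
    x                   ∎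
    where
    cancel : ∀ y → D⁻¹ * (D * y) ≈ y
    cancel y = trans (sym (*-assoc _ _ _)) (trans (*-congʳ (trans (*-comm D⁻¹ D) DD⁻¹≈1)) (*-identityˡ y))

m+n<o+p⇒m<o⊎n<p : ∀ m n o p → m ℕ.+ n < o ℕ.+ p → m < o ⊎ n < p
m+n<o+p⇒m<o⊎n<p m n o p lt with m ℕP.<? o | n ℕP.<? p
... | yes m<o | _       = inj₁ m<o
... | no  _   | yes n<p = inj₂ n<p
... | no  m≮o | no  n≮p = ⊥-elim (ℕP.<⇒≱ lt (ℕP.+-mono-≤ (ℕP.≮⇒≥ m≮o) (ℕP.≮⇒≥ n≮p)))

Outside : ℕ → ℕ → ℕ → ℕ → ℕ → Set
Outside H lo hi c a = H < a ⊎ (c ℕ.+ lo < a ⊎ a ℕ.+ hi < c)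

Outside-+ : ∀ {H₁ H₂ lo₁ lo₂ hi₁ hi₂} c₁ c₂ a₁ a₂ →
  Outside (H₁ ℕ.+ H₂) (lo₁ ℕ.+ lo₂) (hi₁ ℕ.+ hi₂) (c₁ ℕ.+ c₂) (a₁ ℕ.+ a₂) →
  Outside H₁ lo₁ hi₁ c₁ a₁ ⊎ Outside H₂ lo₂ hi₂ c₂ a₂
Outside-+ {H₁} {H₂} c₁ c₂ a₁ a₂ (inj₁ H<a) =
  Sum.map inj₁ inj₁ (m+n<o+p⇒m<o⊎n<p H₁ H₂ a₁ a₂ H<a)
Outside-+ {lo₁ = lo₁} {lo₂} c₁ c₂ a₁ a₂ (inj₂ (inj₁ c+lo<a)) =
  Sum.map (inj₂ ∘ inj₁) (inj₂ ∘ inj₁)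
    (m+n<o+p⇒m<o⊎n<p (c₁ ℕ.+ lo₁) (c₂ ℕ.+ lo₂) a₁ a₂ (ℕP.≤-trans (s≤s (ℕP.≤-reflexive (interchange c₁ lo₁ c₂ lo₂))) c+lo<a))
Outside-+ {hi₁ = hi₁} {hi₂} c₁ c₂ a₁ a₂ (inj₂ (inj₂ a+hi<c)) =
  Sum.map (inj₂ ∘ inj₂) (inj₂ ∘ inj₂)
    (m+n<o+p⇒m<o⊎n<p (a₁ ℕ.+ hi₁) (a₂ ℕ.+ hi₂) c₁ c₂ (ℕP.≤-trans (s≤s (ℕP.≤-reflexive (interchange a₁ hi₁ a₂ hi₂))) a+hi<c))

-- Support of a q-th diagonal section of a product A · B^(q−1), A in the box (h, 0, d′ + 1) and B in (h, 1, d′);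
-- the +1 in the upper bound of A is absorbed because q ≥ 2.
Outside-section : ∀ {q′ h d′ c a} j → 1 ≤ q′ → Outside h 0 d′ c a →
  Outside (h ℕ.+ q′ ℕ.* h) (0 ℕ.+ q′ ℕ.* 1) (suc d′ ℕ.+ q′ ℕ.* d′) (suc q′ ℕ.* c ℕ.+ j) (suc q′ ℕ.* a ℕ.+ j)
Outside-section {q′} {h} j _ (inj₁ h<a) =
  inj₁ (ℕP.≤-trans (ℕP.≤-reflexive (≡.cong suc (lemma q′ h))) (ℕP.≤-trans (ℕP.*-monoʳ-< (suc q′) h<a) (ℕP.m≤m+n _ j)))
  where
  lemma : ∀ q′ h → h ℕ.+ q′ ℕ.* h ≡ suc q′ ℕ.* h
  lemma = solve-∀
Outside-section {q′} {c = c} j _ (inj₂ (inj₁ c<a)) =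
  inj₂ (inj₁ (ℕP.≤-trans (ℕP.≤-reflexive (lemma q′ c j))
                         (ℕP.+-monoˡ-≤ j (ℕP.*-monoʳ-≤ (suc q′) (ℕP.≤-trans (s≤s (ℕP.≤-reflexive (≡.sym (ℕP.+-identityʳ c)))) c<a)))))
  where
  lemma : ∀ q′ c j → suc (suc q′ ℕ.* c ℕ.+ j ℕ.+ (0 ℕ.+ q′ ℕ.* 1)) ≡ suc q′ ℕ.* suc c ℕ.+ j
  lemma = solve-∀
Outside-section {q′} {d′ = d′} {a = a} j 1≤q′ (inj₂ (inj₂ a+d′<c)) =
  inj₂ (inj₂ (ℕP.≤-trans (ℕP.≤-reflexive (lemma₁ q′ a d′ j))
             (ℕP.≤-trans (ℕP.+-monoʳ-≤ (suc q′ ℕ.* (a ℕ.+ d′) ℕ.+ j) (s≤s 1≤q′))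
             (ℕP.≤-trans (ℕP.≤-reflexive (lemma₂ q′ a d′ j)) (ℕP.+-monoˡ-≤ j (ℕP.*-monoʳ-≤ (suc q′) a+d′<c))))))
  where
  lemma₁ : ∀ q′ a d′ j → suc (suc q′ ℕ.* a ℕ.+ j ℕ.+ (suc d′ ℕ.+ q′ ℕ.* d′)) ≡ suc q′ ℕ.* (a ℕ.+ d′) ℕ.+ j ℕ.+ 2
  lemma₁ = solve-∀
  lemma₂ : ∀ q′ a d′ j → suc q′ ℕ.* (a ℕ.+ d′) ℕ.+ j ℕ.+ suc q′ ≡ suc q′ ℕ.* suc (a ℕ.+ d′) ℕ.+ j
  lemma₂ = solve-∀

module Horner {c ℓ} (R : CommutativeRing c ℓ) where
  open CommutativeRing R
  open Exp semiring using (_^_)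
  open Over R using (sumTo)
  open FiniteSums R using (sumTo-cong; sumTo-head; *-distribˡ-sumTo)
  open import Relation.Binary.Reasoning.Setoid setoid
  open import Algebra.Solver.Ring.NaturalCoefficients.Default commutativeSemiring

  horner : ℕ → (ℕ → Carrier) → Carrier → Carrier
  horner zero    cf z = 0#
  horner (suc n) cf z = cf 0 + z * horner n (cf ∘ suc) z

  horner-sum : ∀ n (cf : ℕ → Carrier) z → horner n cf z ≈ sumTo n (λ j → cf j * z ^ j)
  horner-sum zero    cf z = refl
  horner-sum (suc n) cf z = begin
    cf 0 + z * horner n (cf ∘ suc) z                   ≈⟨ +-congˡ (*-congˡ (horner-sum n (cf ∘ suc) z)) ⟩
    cf 0 + z * sumTo n (λ j → cf (suc j) * z ^ j)      ≈⟨ +-cong (sym (*-identityʳ (cf 0))) (*-distribˡ-sumTo n z _) ⟩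
    cf 0 * 1# + sumTo n (λ j → z * (cf (suc j) * z ^ j)) ≈⟨ +-congˡ (sumTo-cong n (λ j → x*[y*z]≈y*[x*z] z _ _)) ⟩
    cf 0 * 1# + sumTo n (λ j → cf (suc j) * (z * z ^ j)) ≈⟨ sumTo-head n _ ⟨
    sumTo (suc n) (λ j → cf j * z ^ j)                 ∎
    where
    x*[y*z]≈y*[x*z] : ∀ x y z → x * (y * z) ≈ y * (x * z)
    x*[y*z]≈y*[x*z] = solve 3 (λ x y z → x :* (y :* z) := y :* (x :* z)) refl

  -- For P = horner n cf: hornerQuotient is (P(Y) − P(φ))/(Y − φ) and yDerivative is Y·P′(Y).
  module _ (Y φ : Carrier) where
    hornerQuotient : ℕ → (ℕ → Carrier) → Carrier
    hornerQuotient zero    cf = 0#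
    hornerQuotient (suc n) cf = horner n (cf ∘ suc) Y + φ * hornerQuotient n (cf ∘ suc)

    yDerivative : ℕ → (ℕ → Carrier) → Carrier
    yDerivative zero    cf = 0#
    yDerivative (suc n) cf = Y * horner n (cf ∘ suc) Y + Y * yDerivative n (cf ∘ suc)

    yDerivativeQuotient : ℕ → (ℕ → Carrier) → Carrier
    yDerivativeQuotient zero    cf = 0#
    yDerivativeQuotient (suc n) cf = yDerivative n (cf ∘ suc) + φ * yDerivativeQuotient n (cf ∘ suc)

    private
      D = Y - φ

      Y≈φ+D : Y ≈ φ + D
      Y≈φ+D = sym (begin
        φ + (Y - φ)    ≈⟨ +-congˡ (+-comm Y (- φ)) ⟩
        φ + (- φ + Y)  ≈⟨ +-assoc _ _ _ ⟨
        (φ - φ) + Y    ≈⟨ +-congʳ (-‿inverseʳ φ) ⟩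
        0# + Y         ≈⟨ +-identityˡ Y ⟩
        Y              ∎)

    horner-factor : ∀ n cf → horner n cf Y ≈ horner n cf φ + D * hornerQuotient n cf
    horner-factor zero    cf = sym (trans (+-identityˡ _) (zeroʳ D))
    horner-factor (suc n) cf = begin
      cf 0 + Y * EY                                  ≈⟨ +-congˡ (*-cong Y≈φ+D (horner-factor n (cf ∘ suc))) ⟩
      cf 0 + (φ + D) * (Eφ + D * Q)                  ≈⟨ solve 5 (λ c₀ f d e q → c₀ :+ (f :+ d) :* (e :+ d :* q)
                                                                  := (c₀ :+ f :* e) :+ d :* ((e :+ d :* q) :+ f :* q))
                                                                refl (cf 0) φ D Eφ Q ⟩
      (cf 0 + φ * Eφ) + D * ((Eφ + D * Q) + φ * Q)    ≈⟨ +-congˡ (*-congˡ (+-congʳ (sym (horner-factor n (cf ∘ suc))))) ⟩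
      (cf 0 + φ * Eφ) + D * (EY + φ * Q)             ∎
      where
      EY = horner n (cf ∘ suc) Y
      Eφ = horner n (cf ∘ suc) φ
      Q = hornerQuotient n (cf ∘ suc)

    yDerivative-factor : ∀ n cf → yDerivative n cf ≈ Y * hornerQuotient n cf + D * yDerivativeQuotient n cf
    yDerivative-factor zero    cf = sym (trans (+-cong (zeroʳ Y) (zeroʳ D)) (+-identityˡ 0#))
    yDerivative-factor (suc n) cf = begin
      Y * EY + Y * Dr                                                ≈⟨ +-congˡ (*-congˡ (yDerivative-factor n (cf ∘ suc))) ⟩
      Y * EY + Y * (Y * Qr + D * Wr)                                 ≈⟨ +-congˡ (*-cong Y≈φ+D (+-congʳ (*-congʳ Y≈φ+D))) ⟩
      Y * EY + (φ + D) * ((φ + D) * Qr + D * Wr)                     ≈⟨ solve 5 (λ ye f d q w →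
                                                                          ye :+ (f :+ d) :* ((f :+ d) :* q :+ d :* w)
                                                                          := (ye :+ (f :+ d) :* (f :* q)) :+ d :* (((f :+ d) :* q :+ d :* w) :+ f :* w))
                                                                        refl (Y * EY) φ D Qr Wr ⟩
      (Y * EY + (φ + D) * (φ * Qr)) + D * (((φ + D) * Qr + D * Wr) + φ * Wr)
                                                                     ≈⟨ +-cong (+-congˡ (*-congʳ (sym Y≈φ+D)))
                                                                               (*-congˡ (+-congʳ (+-congʳ (*-congʳ (sym Y≈φ+D))))) ⟩
      (Y * EY + Y * (φ * Qr)) + D * ((Y * Qr + D * Wr) + φ * Wr)     ≈⟨ +-cong (sym (distribˡ Y EY (φ * Qr)))
                                                                               (*-congˡ (+-congʳ (sym (yDerivative-factor n (cf ∘ suc))))) ⟩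
      Y * (EY + φ * Qr) + D * (Dr + φ * Wr)                          ∎
      where
      EY = horner n (cf ∘ suc) Y
      Dr = yDerivative n (cf ∘ suc)
      Qr = hornerQuotient n (cf ∘ suc)
      Wr = yDerivativeQuotient n (cf ∘ suc)

-- A c a is the coefficient of y^c x^a: series in y over series in x.
module Bivariate {c ℓ} (R : CommutativeRing c ℓ) where
  open CommutativeRing R using (Carrier; _≈_; _+_; _*_; 0#; 1#; refl; sym; trans; reflexive; zeroˡ; zeroʳ; +-identityˡ; +-cong; +-congˡ; *-congˡ; *-congʳ)
  open Over R using (Series; oneS; _⊛_; sumTo)
  module X = PowerSeries R
  module Y = PowerSeries X.seriesRing
  open FiniteSums R using (sumTo-vanishes; sumTo-single)
  open Y using (_⊕_; zeroS) renaming (_≋_ to _≋₂_) public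

  bivariateRing : CommutativeRing c ℓ
  bivariateRing = Y.seriesRing

  Series₂ : Set c
  Series₂ = ℕ → ℕ → Carrier

  infixl 7 _·_
  _·_ : Series₂ → Series₂ → Series₂
  _·_ = Over._⊛_ X.seriesRing

  1₂ : Series₂
  1₂ = CommutativeRing.1# bivariateRing

  1₂-off : ∀ c a → 0 < c ⊎ 0 < a → 1₂ c a ≈ 0#
  1₂-off (suc c) a       _ = refl
  1₂-off zero    (suc a) _ = refl
  1₂-off zero    zero    (inj₁ ())
  1₂-off zero    zero    (inj₂ ())

  ·-coeff-vanishes : ∀ A B c a →
    (∀ c₁ c₂ a₁ a₂ → c₁ ℕ.+ c₂ ≡ c → a₁ ℕ.+ a₂ ≡ a → A c₁ a₁ ≈ 0# ⊎ B c₂ a₂ ≈ 0#) → (A · B) c a ≈ 0#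
  ·-coeff-vanishes A B c a someFactor≈0 =
    trans (X.sumTo-coeff (suc c) _ a)
      (sumTo-vanishes (suc c) (λ c₁ c₁<1+c → sumTo-vanishes (suc a) (λ a₁ a₁<1+a → term (ℕP.≤-pred c₁<1+c) (ℕP.≤-pred a₁<1+a))))
    where
    term : ∀ {c₁ a₁} → c₁ ≤ c → a₁ ≤ a → A c₁ a₁ * B (c ∸ c₁) (a ∸ a₁) ≈ 0#
    term {c₁} {a₁} c₁≤c a₁≤a with someFactor≈0 c₁ (c ∸ c₁) a₁ (a ∸ a₁) (ℕP.m+[n∸m]≡n c₁≤c) (ℕP.m+[n∸m]≡n a₁≤a)
    ... | inj₁ A≈0 = trans (*-congʳ A≈0) (zeroˡ _)
    ... | inj₂ B≈0 = trans (*-congˡ B≈0) (zeroʳ _)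

  ·-coeff-single : ∀ A B c a c₀ a₀ → c₀ ≤ c → a₀ ≤ a →
    (∀ c₁ a₁ → c₁ ≤ c → a₁ ≤ a → (c₁ ≢ c₀ ⊎ a₁ ≢ a₀) → A c₁ a₁ * B (c ∸ c₁) (a ∸ a₁) ≈ 0#) →
    (A · B) c a ≈ A c₀ a₀ * B (c ∸ c₀) (a ∸ a₀)
  ·-coeff-single A B c a c₀ a₀ c₀≤c a₀≤a others≈0 =
    trans (X.sumTo-coeff (suc c) _ a)
      (trans (sumTo-single (suc c) c₀ _ (s≤s c₀≤c)
                (λ c₁ c₁<1+c c₁≢c₀ → sumTo-vanishes (suc a) (λ a₁ a₁<1+a →
                   others≈0 c₁ a₁ (ℕP.≤-pred c₁<1+c) (ℕP.≤-pred a₁<1+a) (inj₁ c₁≢c₀))))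
             (sumTo-single (suc a) a₀ _ (s≤s a₀≤a) (λ a₁ a₁<1+a a₁≢a₀ → others≈0 c₀ a₁ c₀≤c (ℕP.≤-pred a₁<1+a) (inj₂ a₁≢a₀))))

  inverse-coeff-vanishes : ∀ U V → (U · V) ≋₂ 1₂ → ∀ c a → 0 < c ⊎ 0 < a →
    (∀ c₁ a₁ → c₁ ≤ c → a₁ ≤ a → (c₁ ≢ 0 ⊎ a₁ ≢ 0) → U c₁ a₁ * V (c ∸ c₁) (a ∸ a₁) ≈ 0#) → V c a ≈ 0#
  inverse-coeff-vanishes U V UV≈1 c a nonconstant others≈0 = begin
    V c a                      ≈⟨ *-identityˡ _ ⟨
    1# * V c a                 ≈⟨ *-congʳ (trans (sym U₀₀V₀₀≈1) (*-comm _ _)) ⟩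
    (V 0 0 * U 0 0) * V c a    ≈⟨ *-assoc _ _ _ ⟩
    V 0 0 * (U 0 0 * V c a)    ≈⟨ *-congˡ (trans (sym (·-coeff-single U V c a 0 0 z≤n z≤n others≈0))
                                                 (trans (UV≈1 c a) (1₂-off c a nonconstant))) ⟩
    V 0 0 * 0#                 ≈⟨ zeroʳ _ ⟩
    0#                         ∎
    where
    open CommutativeRing R using (*-identityˡ; *-comm; *-assoc)
    open import Relation.Binary.Reasoning.Setoid (CommutativeRing.setoid R)
    U₀₀V₀₀≈1 : U 0 0 * V 0 0 ≈ 1#
    U₀₀V₀₀≈1 = trans (sym (·-coeff-single U V 0 0 0 0 z≤n z≤n constantTerm)) (UV≈1 0 0)
      where
      constantTerm : ∀ c₁ a₁ → c₁ ≤ 0 → a₁ ≤ 0 → (c₁ ≢ 0 ⊎ a₁ ≢ 0) → U c₁ a₁ * V (0 ∸ c₁) (0 ∸ a₁) ≈ 0#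
      constantTerm zero zero z≤n z≤n (inj₁ 0≢0) = ⊥-elim (0≢0 ≡.refl)
      constantTerm zero zero z≤n z≤n (inj₂ 0≢0) = ⊥-elim (0≢0 ≡.refl)

  SupportedIn : ℕ → ℕ → ℕ → Series₂ → Set ℓ
  SupportedIn H lo hi A = ∀ c a → Outside H lo hi c a → A c a ≈ 0#

  module _ {H lo hi : ℕ} where
    SupportedIn-cong : ∀ {A B} → A ≋₂ B → SupportedIn H lo hi A → SupportedIn H lo hi B
    SupportedIn-cong A≋B A-supp c a out = trans (sym (A≋B c a)) (A-supp c a out)

    SupportedIn-zero : SupportedIn H lo hi zeroS
    SupportedIn-zero c a out = refl

    SupportedIn-⊕ : ∀ {A B} → SupportedIn H lo hi A → SupportedIn H lo hi B → SupportedIn H lo hi (A ⊕ B)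
    SupportedIn-⊕ A-supp B-supp c a out = trans (+-cong (A-supp c a out) (B-supp c a out)) (+-identityˡ 0#)

    SupportedIn-weaken : ∀ {H′ lo′ hi′ A} → H ≤ H′ → lo ≤ lo′ → hi ≤ hi′ → SupportedIn H lo hi A → SupportedIn H′ lo′ hi′ A
    SupportedIn-weaken H≤ lo≤ hi≤ A-supp c a (inj₁ H′<a)          = A-supp c a (inj₁ (ℕP.≤-<-trans H≤ H′<a))
    SupportedIn-weaken H≤ lo≤ hi≤ A-supp c a (inj₂ (inj₁ c+lo′<a)) = A-supp c a (inj₂ (inj₁ (ℕP.≤-<-trans (ℕP.+-monoʳ-≤ c lo≤) c+lo′<a)))
    SupportedIn-weaken H≤ lo≤ hi≤ A-supp c a (inj₂ (inj₂ a+hi′<c)) = A-supp c a (inj₂ (inj₂ (ℕP.≤-<-trans (ℕP.+-monoʳ-≤ a hi≤) a+hi′<c)))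

  SupportedIn-· : ∀ {H₁ H₂ lo₁ lo₂ hi₁ hi₂ A B} → SupportedIn H₁ lo₁ hi₁ A → SupportedIn H₂ lo₂ hi₂ B →
    SupportedIn (H₁ ℕ.+ H₂) (lo₁ ℕ.+ lo₂) (hi₁ ℕ.+ hi₂) (A · B)
  SupportedIn-· {A = A} {B} A-supp B-supp c a out = ·-coeff-vanishes A B c a someFactor≈0
    where
    someFactor≈0 : ∀ c₁ c₂ a₁ a₂ → c₁ ℕ.+ c₂ ≡ c → a₁ ℕ.+ a₂ ≡ a → A c₁ a₁ ≈ 0# ⊎ B c₂ a₂ ≈ 0#
    someFactor≈0 c₁ c₂ a₁ a₂ ≡.refl ≡.refl = Sum.map (A-supp c₁ a₁) (B-supp c₂ a₂) (Outside-+ c₁ c₂ a₁ a₂ out)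

  SupportedIn-1₂ : SupportedIn 0 0 0 1₂
  SupportedIn-1₂ zero    zero    (inj₁ ())
  SupportedIn-1₂ zero    zero    (inj₂ (inj₁ ()))
  SupportedIn-1₂ zero    zero    (inj₂ (inj₂ ()))
  SupportedIn-1₂ zero    (suc a) out = refl
  SupportedIn-1₂ (suc c) a       out = refl

  SupportedIn-^ : ∀ {H lo hi A} n → SupportedIn H lo hi A → SupportedIn (n ℕ.* H) (n ℕ.* lo) (n ℕ.* hi) (A Y.^ˢ n)
  SupportedIn-^ zero    A-supp = SupportedIn-1₂
  SupportedIn-^ {A = A} (suc n) A-supp = SupportedIn-· {A = A} A-supp (SupportedIn-^ n A-supp)

  YDominant XDominant : Series₂ → Set ℓ
  YDominant A = ∀ c a → c < a → A c a ≈ 0#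
  XDominant A = ∀ c a → a < c → A c a ≈ 0#

  YDominant-zero : YDominant zeroS
  YDominant-zero c a c<a = refl

  YDominant-⊕ : ∀ {A B} → YDominant A → YDominant B → YDominant (A ⊕ B)
  YDominant-⊕ A-dom B-dom c a c<a = trans (+-cong (A-dom c a c<a) (B-dom c a c<a)) (+-identityˡ 0#)

  YDominant-· : ∀ {A B} → YDominant A → YDominant B → YDominant (A · B)
  YDominant-· {A} {B} A-dom B-dom c a c<a = ·-coeff-vanishes A B c a someFactor≈0
    where
    someFactor≈0 : ∀ c₁ c₂ a₁ a₂ → c₁ ℕ.+ c₂ ≡ c → a₁ ℕ.+ a₂ ≡ a → A c₁ a₁ ≈ 0# ⊎ B c₂ a₂ ≈ 0#
    someFactor≈0 c₁ c₂ a₁ a₂ ≡.refl ≡.refl = Sum.map (A-dom c₁ a₁) (B-dom c₂ a₂) (m+n<o+p⇒m<o⊎n<p c₁ c₂ a₁ a₂ c<a)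

  -- Both inverse lemmas go by induction on the smaller degree: every term of (U · V) c a
  -- other than U 0 0 * V c a involves a coefficient of V of smaller degree, or one of U that vanishes.
  YDominant-inverse : ∀ U V → YDominant U → (U · V) ≋₂ 1₂ → YDominant V
  YDominant-inverse U V U-dom UV≈1 c a c<a = go (suc c) c (ℕP.n<1+n c) a c<a
    where
    go : ∀ n c → c < n → ∀ a → c < a → V c a ≈ 0#
    go (suc n) c (s≤s c≤n) a c<a = inverse-coeff-vanishes U V UV≈1 c a (inj₂ (ℕP.≤-<-trans z≤n c<a)) term
      where
      term : ∀ c₁ a₁ → c₁ ≤ c → a₁ ≤ a → (c₁ ≢ 0 ⊎ a₁ ≢ 0) → U c₁ a₁ * V (c ∸ c₁) (a ∸ a₁) ≈ 0#
      term c₁ a₁ c₁≤c a₁≤a nonzero with c₁ ℕP.<? a₁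
      ... | yes c₁<a₁ = trans (*-congʳ (U-dom c₁ a₁ c₁<a₁)) (zeroˡ _)
      ... | no  c₁≮a₁ = trans (*-congˡ (go n (c ∸ c₁) (ℕP.<-≤-trans (ℕP.∸-monoʳ-< 0<c₁ c₁≤c) c≤n) (a ∸ a₁) c∸c₁<a∸a₁)) (zeroʳ _)
        where
        a₁≤c₁ = ℕP.≮⇒≥ c₁≮a₁
        0<c₁ : 0 < c₁
        0<c₁ = [ ℕP.n≢0⇒n>0 , (λ a₁≢0 → ℕP.<-≤-trans (ℕP.n≢0⇒n>0 a₁≢0) a₁≤c₁) ] nonzero
        c∸c₁<a∸a₁ : c ∸ c₁ < a ∸ a₁
        c∸c₁<a∸a₁ = ℕP.<-≤-trans (ℕP.∸-monoˡ-< {c} {c₁} {a} c<a c₁≤c) (ℕP.∸-monoʳ-≤ a a₁≤c₁)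

  XDominant-inverse : ∀ U V → XDominant U → (U · V) ≋₂ 1₂ → XDominant V
  XDominant-inverse U V U-dom UV≈1 c a a<c = go (suc a) a (ℕP.n<1+n a) c a<c
    where
    go : ∀ n a → a < n → ∀ c → a < c → V c a ≈ 0#
    go (suc n) a (s≤s a≤n) c a<c = inverse-coeff-vanishes U V UV≈1 c a (inj₁ (ℕP.≤-<-trans z≤n a<c)) term
      where
      term : ∀ c₁ a₁ → c₁ ≤ c → a₁ ≤ a → (c₁ ≢ 0 ⊎ a₁ ≢ 0) → U c₁ a₁ * V (c ∸ c₁) (a ∸ a₁) ≈ 0#
      term c₁ a₁ c₁≤c a₁≤a nonzero with a₁ ℕP.<? c₁
      ... | yes a₁<c₁ = trans (*-congʳ (U-dom c₁ a₁ a₁<c₁)) (zeroˡ _)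
      ... | no  a₁≮c₁ = trans (*-congˡ (go n (a ∸ a₁) (ℕP.<-≤-trans (ℕP.∸-monoʳ-< 0<a₁ a₁≤a) a≤n) (c ∸ c₁) a∸a₁<c∸c₁)) (zeroʳ _)
        where
        c₁≤a₁ = ℕP.≮⇒≥ a₁≮c₁
        0<a₁ : 0 < a₁
        0<a₁ = [ (λ c₁≢0 → ℕP.<-≤-trans (ℕP.n≢0⇒n>0 c₁≢0) c₁≤a₁) , ℕP.n≢0⇒n>0 ] nonzero
        a∸a₁<c∸c₁ : a ∸ a₁ < c ∸ c₁
        a∸a₁<c∸c₁ = ℕP.<-≤-trans (ℕP.∸-monoˡ-< {a} {a₁} {c} a<c a₁≤a) (ℕP.∸-monoʳ-≤ c c₁≤a₁)

  y : Series₂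
  y = Y.monomial 1 oneS

  y-diagonal : ∀ n → y n n ≈ 0#
  y-diagonal zero          = refl
  y-diagonal (suc zero)    = refl
  y-diagonal (suc (suc n)) = refl

  YDominant-y : YDominant y
  YDominant-y zero                (suc a)       _ = refl
  YDominant-y (suc zero)          (suc zero)    (s≤s ())
  YDominant-y (suc zero)          (suc (suc a)) _ = refl
  YDominant-y (suc (suc c))       a             _ = refl

  SupportedIn-y : SupportedIn 0 0 1 y
  SupportedIn-y zero             a       out = refl
  SupportedIn-y (suc zero)       zero    (inj₁ ())
  SupportedIn-y (suc zero)       zero    (inj₂ (inj₁ ()))
  SupportedIn-y (suc zero)       zero    (inj₂ (inj₂ (s≤s ())))
  SupportedIn-y (suc zero)       (suc a) out = refl
  SupportedIn-y (suc (suc c))    a       out = refl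

  y·-coeff-suc : ∀ A c → (y · A) (suc c) X.≋ A c
  y·-coeff-suc A c n = trans (Y.monomial⊛-coeff 1 oneS A c n) (X.⊛-identityˡ (A c) n)

  y·-coeff-zero : ∀ A → (y · A) 0 X.≋ X.zeroS
  y·-coeff-zero A = Y.monomial⊛-coeff-< 1 oneS A 0 (s≤s z≤n)

  -- atXY s is s(xy), a series in y with coefficients s c · x^c.
  atXY : Series → Series₂
  atXY s c = X.monomial c (s c)

  atXY-cong : ∀ {s t} → s X.≋ t → atXY s ≋₂ atXY t
  atXY-cong s≋t c = X.monomial-cong c (s≋t c)

  atXY-⊕ : ∀ s t → atXY (s X.⊕ t) ≋₂ (atXY s ⊕ atXY t)
  atXY-⊕ s t c = X.monomial-+ c (s c) (t c)

  atXY-zero : atXY X.zeroS ≋₂ zeroS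
  atXY-zero c i with i ℕP.≟ c
  ... | yes ≡.refl = reflexive (X.monomial-at i 0#)
  ... | no  i≢c    = X.monomial-off c 0# i i≢c

  atXY-⊛ : ∀ s t → atXY (s ⊛ t) ≋₂ (atXY s · atXY t)
  atXY-⊛ s t c i = sym (begin
    (atXY s · atXY t) c i
      ≈⟨ X.sumTo-coeff (suc c) _ i ⟩
    sumTo (suc c) (λ k → (X.monomial k (s k) ⊛ X.monomial (c ∸ k) (t (c ∸ k))) i)
      ≈⟨ FiniteSums.sumTo-cong-< R (suc c) (λ k k<1+c → trans (X.monomial⊛monomial k (c ∸ k) (s k) (t (c ∸ k)) i)
           (reflexive (≡.cong (λ m → X.monomial m (s k * t (c ∸ k)) i) (ℕP.m+[n∸m]≡n (ℕP.≤-pred k<1+c))))) ⟩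
    sumTo (suc c) (λ k → X.monomial c (s k * t (c ∸ k)) i)
      ≈⟨ X.monomial-sumTo c (suc c) _ i ⟩
    X.monomial c ((s ⊛ t) c) i
      ∎)
    where
    open import Relation.Binary.Reasoning.Setoid (CommutativeRing.setoid R)

  YDominant-atXY : ∀ s → YDominant (atXY s)
  YDominant-atXY s c a c<a = X.monomial-off c (s c) a (ℕP.>⇒≢ c<a)

  horner-atXY : ∀ n (cf : ℕ → Series) s →
    Horner.horner bivariateRing n (atXY ∘ cf) (atXY s) ≋₂ atXY (Horner.horner X.seriesRing n cf s)
  horner-atXY zero    cf s c i = sym (atXY-zero c i)
  horner-atXY (suc n) cf s c i = begin
    atXY (cf 0) c i + (atXY s · horner₂ n (atXY ∘ cf ∘ suc) (atXY s)) c i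
      ≈⟨ +-congˡ (Y.⊛-cong {atXY s} (λ _ _ → refl) (horner-atXY n (cf ∘ suc) s) c i) ⟩
    atXY (cf 0) c i + (atXY s · atXY (horner₁ n (cf ∘ suc) s)) c i
      ≈⟨ +-congˡ (sym (atXY-⊛ s (horner₁ n (cf ∘ suc) s) c i)) ⟩
    atXY (cf 0) c i + atXY (s ⊛ horner₁ n (cf ∘ suc) s) c i
      ≈⟨ sym (atXY-⊕ (cf 0) (s ⊛ horner₁ n (cf ∘ suc) s) c i) ⟩
    atXY (horner₁ (suc n) cf s) c i
      ∎
    where
    open import Relation.Binary.Reasoning.Setoid (CommutativeRing.setoid R)
    horner₁ = Horner.horner X.seriesRing
    horner₂ = Horner.horner bivariateRing

  y·-diagonal : ∀ A → YDominant A → ∀ n → (y · A) n n ≈ 0#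
  y·-diagonal A A-dom zero    = y·-coeff-zero A 0
  y·-diagonal A A-dom (suc n) = trans (y·-coeff-suc A n (suc n)) (A-dom n (suc n) (ℕP.n<1+n n))

module Furstenberg {c ℓ} (F : CommutativeRing c ℓ) (a : Over.Series F) (d : ℕ) (P : Over.Poly2 F) where
  open CommutativeRing F
    using (Carrier; _≈_; _+_; _*_; -_; 0#; 1#; refl; sym; trans; reflexive; zeroˡ; zeroʳ;
           +-identityˡ; +-identityʳ; *-identityˡ; *-identityʳ; +-cong; +-congˡ; *-cong; *-congˡ; *-congʳ; -‿cong)
  open import Algebra.Properties.Ring (CommutativeRing.ring F) using (-0#≈0#)
  open Over F using (Series)
  open Bivariate F
  private
    module B = CommutativeRing bivariateRing
  open Horner bivariateRing using (horner; hornerQuotient; yDerivative; yDerivativeQuotient; horner-factor; yDerivative-factor)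

  yCoeff : ℕ → Series
  yCoeff j i = P i j

  P[xy,y] f[xy] f[xy]/y E U S W Q : Series₂
  P[xy,y] = horner (suc d) (atXY ∘ yCoeff) y
  f[xy]   = atXY a
  f[xy]/y c = X.monomial (suc c) (a (suc c))
  E = 1₂ ⊕ (B.- f[xy]/y)
  U = hornerQuotient y f[xy] (suc d) (atXY ∘ yCoeff)
  S = yDerivative y f[xy] (suc d) (atXY ∘ yCoeff)
  W = yDerivativeQuotient y f[xy] (suc d) (atXY ∘ yCoeff)
  Q c = P[xy,y] (suc c)

  f[xy]≋y·f[xy]/y : a 0 ≈ 0# → f[xy] ≋₂ (y · f[xy]/y)
  f[xy]≋y·f[xy]/y a₀≈0 zero    zero    = trans a₀≈0 (sym (y·-coeff-zero f[xy]/y 0))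
  f[xy]≋y·f[xy]/y a₀≈0 zero    (suc n) = sym (y·-coeff-zero f[xy]/y (suc n))
  f[xy]≋y·f[xy]/y a₀≈0 (suc c) n       = sym (y·-coeff-suc f[xy]/y c n)

  YDominant-horner : ∀ n cf → (∀ j → YDominant (cf j)) → ∀ z → YDominant z → YDominant (horner n cf z)
  YDominant-horner zero    cf cf-dom z z-dom = YDominant-zero
  YDominant-horner (suc n) cf cf-dom z z-dom =
    YDominant-⊕ {cf 0} (cf-dom 0) (YDominant-· {z} z-dom (YDominant-horner n (cf ∘ suc) (cf-dom ∘ suc) z z-dom))

  YDominant-hornerQuotient : ∀ n cf → (∀ j → YDominant (cf j)) → YDominant (hornerQuotient y f[xy] n cf)
  YDominant-hornerQuotient zero    cf cf-dom = YDominant-zero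
  YDominant-hornerQuotient (suc n) cf cf-dom = YDominant-⊕ {horner n (cf ∘ suc) y}
    (YDominant-horner n (cf ∘ suc) (cf-dom ∘ suc) y YDominant-y)
    (YDominant-· {f[xy]} (YDominant-atXY a) (YDominant-hornerQuotient n (cf ∘ suc) (cf-dom ∘ suc)))

  YDominant-yDerivative : ∀ n cf → (∀ j → YDominant (cf j)) → YDominant (yDerivative y f[xy] n cf)
  YDominant-yDerivative zero    cf cf-dom = YDominant-zero
  YDominant-yDerivative (suc n) cf cf-dom = YDominant-⊕ {y · horner n (cf ∘ suc) y}
    (YDominant-· {y} YDominant-y (YDominant-horner n (cf ∘ suc) (cf-dom ∘ suc) y YDominant-y))
    (YDominant-· {y} YDominant-y (YDominant-yDerivative n (cf ∘ suc) (cf-dom ∘ suc)))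

  YDominant-yDerivativeQuotient : ∀ n cf → (∀ j → YDominant (cf j)) → YDominant (yDerivativeQuotient y f[xy] n cf)
  YDominant-yDerivativeQuotient zero    cf cf-dom = YDominant-zero
  YDominant-yDerivativeQuotient (suc n) cf cf-dom = YDominant-⊕ {yDerivative y f[xy] n (cf ∘ suc)}
    (YDominant-yDerivative n (cf ∘ suc) (cf-dom ∘ suc))
    (YDominant-· {f[xy]} (YDominant-atXY a) (YDominant-yDerivativeQuotient n (cf ∘ suc) (cf-dom ∘ suc)))

  YDominant-U : YDominant U
  YDominant-U = YDominant-hornerQuotient (suc d) (atXY ∘ yCoeff) (YDominant-atXY ∘ yCoeff)

  YDominant-W : YDominant W
  YDominant-W = YDominant-yDerivativeQuotient (suc d) (atXY ∘ yCoeff) (YDominant-atXY ∘ yCoeff)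

  XDominant-E : XDominant E
  XDominant-E (suc c) a′ a′<1+c =
    trans (+-identityˡ _) (trans (-‿cong (X.monomial-off (suc (suc c)) _ a′ (ℕP.<⇒≢ (ℕP.<-trans a′<1+c (ℕP.n<1+n _))))) -0#≈0#)

  E-diagonal : ∀ c → 0 < c → E c c ≈ 0#
  E-diagonal (suc c) _ = trans (+-identityˡ _) (trans (-‿cong (X.monomial-off (suc (suc c)) _ (suc c) (ℕP.<⇒≢ (ℕP.n<1+n _)))) -0#≈0#)

  E₀₀≈1 : E 0 0 ≈ 1#
  E₀₀≈1 = trans (+-congˡ -0#≈0#) (+-identityʳ 1#)

  E·-inverse-diagonal : ∀ A → (E · A) ≋₂ 1₂ → XDominant A → ∀ n → A n n ≈ 1₂ n n
  E·-inverse-diagonal A EA≈1 A-dom n = begin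
    A n n                        ≈⟨ *-identityˡ _ ⟨
    1# * A n n                   ≈⟨ *-congʳ E₀₀≈1 ⟨
    E 0 0 * A (n ∸ 0) (n ∸ 0)     ≈⟨ ·-coeff-single E A n n 0 0 z≤n z≤n others≈0 ⟨
    (E · A) n n                  ≈⟨ EA≈1 n n ⟩
    1₂ n n                       ∎
    where
    open import Relation.Binary.Reasoning.Setoid (CommutativeRing.setoid F)
    others≈0 : ∀ c₁ a₁ → c₁ ≤ n → a₁ ≤ n → (c₁ ≢ 0 ⊎ a₁ ≢ 0) → E c₁ a₁ * A (n ∸ c₁) (n ∸ a₁) ≈ 0#
    others≈0 c₁ a₁ c₁≤n a₁≤n nonzero with ℕP.<-cmp c₁ a₁
    ... | tri< c₁<a₁ _ _ = trans (*-congˡ (A-dom _ _ (ℕP.∸-monoʳ-< c₁<a₁ a₁≤n))) (zeroʳ _)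
    ... | tri> _ _ a₁<c₁ = trans (*-congʳ (XDominant-E c₁ a₁ a₁<c₁)) (zeroˡ _)
    ... | tri≈ _ ≡.refl _ = trans (*-congʳ (E-diagonal c₁ (ℕP.n≢0⇒n>0 ([ id , id ] nonzero)))) (zeroˡ _)

  module _ {h : ℕ} (P-degX : ∀ i j → h < i → P i j ≈ 0#) (P[x,f]≈0 : ∀ n → Over.evalCoeff F P h d a n ≈ 0#) where
    open Over F using (sumTo; powS; _⊛_; evalCoeff)
    open FiniteSums F using (sumTo-cong; sumTo-cong-<; sumTo-extend; sumTo-swap)
    open import Relation.Binary.Reasoning.Setoid (CommutativeRing.setoid F)

    private
      [_≤_] : ℕ → ℕ → Carrier
      [ i ≤ n ] with i ℕ.≤? n
      ... | yes _ = 1#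
      ... | no  _ = 0#

      -- The indicator inside evalCoeff is a local definition; its name is recovered by unification.
      mutual
        evalCoeff≈ : ∀ n → evalCoeff P h d a n ≈ sumTo (suc h) λ i → sumTo (suc d) λ j → P i j * powS a j (n ∸ i) * [ i ≤ n ]
        evalCoeff≈ n = sumTo-cong (suc h) λ i → sumTo-cong (suc d) λ j → *-congˡ (indicator n i)

        indicator : ∀ n i → _ ≈ [ i ≤ n ]
        indicator n i with i ℕ.≤? n
        ... | yes _ = refl
        ... | no  _ = refl

      [≤]-yes : ∀ {i n} → i ≤ n → [ i ≤ n ] ≈ 1#
      [≤]-yes {i} {n} i≤n with i ℕ.≤? n
      ... | yes _   = refl
      ... | no  i≰n = ⊥-elim (i≰n i≤n)

      [≤]-no : ∀ {i n} → n < i → [ i ≤ n ] ≈ 0#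
      [≤]-no {i} {n} n<i with i ℕ.≤? n
      ... | yes i≤n = ⊥-elim (ℕP.<⇒≱ n<i i≤n)
      ... | no  _   = refl

      column : ∀ n j → sumTo (suc h) (λ i → P i j * powS a j (n ∸ i) * [ i ≤ n ]) ≈ (yCoeff j ⊛ powS a j) n
      column n j = begin
        sumTo (suc h) g       ≈⟨ sumTo-extend (suc h) (suc (h ℕ.+ n)) g (s≤s (ℕP.m≤m+n h n)) beyond-h ⟨
        sumTo (suc (h ℕ.+ n)) g ≈⟨ sumTo-extend (suc n) (suc (h ℕ.+ n)) g (s≤s (ℕP.m≤n+m n h)) beyond-n ⟩
        sumTo (suc n) g       ≈⟨ sumTo-cong-< (suc n) (λ i i<1+n → trans (*-congˡ ([≤]-yes (ℕP.≤-pred i<1+n))) (*-identityʳ _)) ⟩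
        (yCoeff j ⊛ powS a j) n ∎
        where
        g = λ i → P i j * powS a j (n ∸ i) * [ i ≤ n ]
        beyond-h : ∀ i → suc h ≤ i → i < suc (h ℕ.+ n) → g i ≈ 0#
        beyond-h i h<i _ = trans (*-congʳ (trans (*-congʳ (P-degX i j h<i)) (zeroˡ _))) (zeroˡ _)
        beyond-n : ∀ i → suc n ≤ i → i < suc (h ℕ.+ n) → g i ≈ 0#
        beyond-n i n<i _ = trans (*-congˡ ([≤]-no n<i)) (zeroʳ _)

      P[x,f]≋0 : Horner.horner X.seriesRing (suc d) yCoeff a X.≋ X.zeroS
      P[x,f]≋0 n = begin
        Horner.horner X.seriesRing (suc d) yCoeff a n
          ≈⟨ Horner.horner-sum X.seriesRing (suc d) yCoeff a n ⟩
        Over.sumTo X.seriesRing (suc d) (λ j → yCoeff j ⊛ (a X.^ˢ j)) n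
          ≈⟨ X.sumTo-coeff (suc d) _ n ⟩
        sumTo (suc d) (λ j → (yCoeff j ⊛ (a X.^ˢ j)) n)
          ≈⟨ sumTo-cong (suc d) (λ j → trans (X.⊛-cong {yCoeff j} (λ _ → refl) (λ k → sym (X.powS≋^ˢ a j k)) n) (sym (column n j))) ⟩
        sumTo (suc d) (λ j → sumTo (suc h) (λ i → P i j * powS a j (n ∸ i) * [ i ≤ n ]))
          ≈⟨ sumTo-swap (suc h) (suc d) _ ⟨
        sumTo (suc h) (λ i → sumTo (suc d) (λ j → P i j * powS a j (n ∸ i) * [ i ≤ n ]))
          ≈⟨ evalCoeff≈ n ⟨
        evalCoeff P h d a n
          ≈⟨ P[x,f]≈0 n ⟩
        0#
          ∎

    P[xy,f[xy]]≋0 : horner (suc d) (atXY ∘ yCoeff) f[xy] ≋₂ zeroS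
    P[xy,f[xy]]≋0 c i = trans (horner-atXY (suc d) yCoeff a c i) (trans (atXY-cong P[x,f]≋0 c i) (atXY-zero c i))

  module Residue (a₀≈0 : a 0 ≈ 0#) (root : horner (suc d) (atXY ∘ yCoeff) f[xy] ≋₂ zeroS)
                 (I : Series₂) (QI≈1 : (Q · I) ≋₂ 1₂) where
    module ≋₂-Reasoning = Relation.Binary.Reasoning.Setoid B.setoid
    open import Algebra.Properties.Ring (CommutativeRing.ring bivariateRing) using (-‿distribʳ-*)

    y-f[xy]≈y·E : (y B.- f[xy]) ≋₂ (y · E)
    y-f[xy]≈y·E = begin
      y ⊕ (B.- f[xy])                     ≈⟨ B.+-congˡ {y} (B.-‿cong {f[xy]} {y · f[xy]/y} (f[xy]≋y·f[xy]/y a₀≈0)) ⟩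
      y ⊕ (B.- (y · f[xy]/y))             ≈⟨ B.+-congʳ {B.- (y · f[xy]/y)} {y} {y · 1₂} (B.sym {y · 1₂} (B.*-identityʳ y)) ⟩
      (y · 1₂) ⊕ (B.- (y · f[xy]/y))      ≈⟨ B.+-congˡ {y · 1₂} (-‿distribʳ-* y f[xy]/y) ⟩
      (y · 1₂) ⊕ (y · (B.- f[xy]/y))      ≈⟨ B.distribˡ y 1₂ (B.- f[xy]/y) ⟨
      y · E                               ∎
      where open ≋₂-Reasoning

    P[xy,y]≈y·E·U : P[xy,y] ≋₂ (y · (E · U))
    P[xy,y]≈y·E·U = begin
      P[xy,y]                                                        ≈⟨ horner-factor y f[xy] (suc d) (atXY ∘ yCoeff) ⟩
      horner (suc d) (atXY ∘ yCoeff) f[xy] ⊕ ((y B.- f[xy]) · U)      ≈⟨ B.+-congʳ {(y B.- f[xy]) · U} root ⟩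
      zeroS ⊕ ((y B.- f[xy]) · U)                                    ≈⟨ B.+-identityˡ ((y B.- f[xy]) · U) ⟩
      (y B.- f[xy]) · U                                              ≈⟨ B.*-congʳ {U} y-f[xy]≈y·E ⟩
      (y · E) · U                                                    ≈⟨ B.*-assoc y E U ⟩
      y · (E · U)                                                    ∎
      where open ≋₂-Reasoning

    Q≈E·U : Q ≋₂ (E · U)
    Q≈E·U c n = trans (P[xy,y]≈y·E·U (suc c) n) (y·-coeff-suc (E · U) c n)

    S≈y·[U+E·W] : S ≋₂ (y · (U ⊕ (E · W)))
    S≈y·[U+E·W] = begin
      S                                   ≈⟨ yDerivative-factor y f[xy] (suc d) (atXY ∘ yCoeff) ⟩
      (y · U) ⊕ ((y B.- f[xy]) · W)       ≈⟨ B.+-congˡ {y · U} (B.trans {(y B.- f[xy]) · W} (B.*-congʳ {W} y-f[xy]≈y·E) (B.*-assoc y E W)) ⟩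
      (y · U) ⊕ (y · (E · W))             ≈⟨ B.distribˡ y U (E · W) ⟨
      y · (U ⊕ (E · W))                   ∎
      where open ≋₂-Reasoning

    E⁻¹ U⁻¹ : Series₂
    E⁻¹ = U · I
    U⁻¹ = E · I

    E·E⁻¹≈1 : (E · E⁻¹) ≋₂ 1₂
    E·E⁻¹≈1 = begin
      E · (U · I)   ≈⟨ B.*-assoc E U I ⟨
      (E · U) · I   ≈⟨ B.*-congʳ {I} (B.sym {Q} Q≈E·U) ⟩
      Q · I         ≈⟨ QI≈1 ⟩
      1₂            ∎
      where open ≋₂-Reasoning

    U·U⁻¹≈1 : (U · U⁻¹) ≋₂ 1₂
    U·U⁻¹≈1 = begin
      U · (E · I)   ≈⟨ B.*-assoc U E I ⟨
      (U · E) · I   ≈⟨ B.*-congʳ {I} (B.trans {U · E} (B.*-comm U E) (B.sym {Q} Q≈E·U)) ⟩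
      Q · I         ≈⟨ QI≈1 ⟩
      1₂            ∎
      where open ≋₂-Reasoning

    S·I≈y·E⁻¹+y·W·U⁻¹ : (S · I) ≋₂ ((y · E⁻¹) ⊕ (y · (W · U⁻¹)))
    S·I≈y·E⁻¹+y·W·U⁻¹ = begin
      S · I                               ≈⟨ B.*-congʳ {I} S≈y·[U+E·W] ⟩
      (y · (U ⊕ (E · W))) · I             ≈⟨ B.*-assoc y (U ⊕ (E · W)) I ⟩
      y · ((U ⊕ (E · W)) · I)             ≈⟨ B.*-congˡ {y} (B.distribʳ I U (E · W)) ⟩
      y · (E⁻¹ ⊕ ((E · W) · I))             ≈⟨ B.distribˡ y E⁻¹ ((E · W) · I) ⟩
      (y · E⁻¹) ⊕ (y · ((E · W) · I))       ≈⟨ B.+-congˡ {y · E⁻¹} (B.*-congˡ {y} (B.trans {(E · W) · I}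
                                               (B.*-congʳ {I} (B.*-comm E W)) (B.*-assoc W E I))) ⟩
      (y · E⁻¹) ⊕ (y · (W · U⁻¹))             ∎
      where open ≋₂-Reasoning

    y·E⁻¹≈y+f[xy]·E⁻¹ : (y · E⁻¹) ≋₂ (y ⊕ (f[xy] · E⁻¹))
    y·E⁻¹≈y+f[xy]·E⁻¹ = begin
      y · E⁻¹                               ≈⟨ B.*-congˡ {y} E⁻¹≈1+f[xy]/y·E⁻¹ ⟩
      y · (1₂ ⊕ (f[xy]/y · E⁻¹))            ≈⟨ B.distribˡ y 1₂ (f[xy]/y · E⁻¹) ⟩
      (y · 1₂) ⊕ (y · (f[xy]/y · E⁻¹))      ≈⟨ B.+-congʳ {y · (f[xy]/y · E⁻¹)} (B.*-identityʳ y) ⟩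
      y ⊕ (y · (f[xy]/y · E⁻¹))             ≈⟨ B.+-congˡ {y} (B.trans {y · (f[xy]/y · E⁻¹)} (B.sym {(y · f[xy]/y) · E⁻¹} (B.*-assoc y f[xy]/y E⁻¹))
                                               (B.*-congʳ {E⁻¹} (B.sym {f[xy]} (f[xy]≋y·f[xy]/y a₀≈0)))) ⟩
      y ⊕ (f[xy] · E⁻¹)                     ∎
      where
      open ≋₂-Reasoning
      E+f[xy]/y≈1 : (E ⊕ f[xy]/y) ≋₂ 1₂
      E+f[xy]/y≈1 = B.trans {E ⊕ f[xy]/y} (B.+-assoc 1₂ (B.- f[xy]/y) f[xy]/y)
                     (B.trans {1₂ ⊕ ((B.- f[xy]/y) ⊕ f[xy]/y)} (B.+-congˡ {1₂} (B.-‿inverseˡ f[xy]/y)) (B.+-identityʳ 1₂))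
      E⁻¹≈1+f[xy]/y·E⁻¹ : E⁻¹ ≋₂ (1₂ ⊕ (f[xy]/y · E⁻¹))
      E⁻¹≈1+f[xy]/y·E⁻¹ = begin
        E⁻¹                                 ≈⟨ B.*-identityˡ E⁻¹ ⟨
        1₂ · E⁻¹                            ≈⟨ B.*-congʳ {E⁻¹} (B.sym {E ⊕ f[xy]/y} E+f[xy]/y≈1) ⟩
        (E ⊕ f[xy]/y) · E⁻¹                 ≈⟨ B.distribʳ E⁻¹ E f[xy]/y ⟩
        (E · E⁻¹) ⊕ (f[xy]/y · E⁻¹)           ≈⟨ B.+-congʳ {f[xy]/y · E⁻¹} E·E⁻¹≈1 ⟩
        1₂ ⊕ (f[xy]/y · E⁻¹)                ∎

    XDominant-E⁻¹ : XDominant E⁻¹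
    XDominant-E⁻¹ = XDominant-inverse E E⁻¹ XDominant-E E·E⁻¹≈1

    YDominant-U⁻¹ : YDominant U⁻¹
    YDominant-U⁻¹ = YDominant-inverse U U⁻¹ YDominant-U U·U⁻¹≈1

    f[xy]·E⁻¹-diagonal : ∀ n → (f[xy] · E⁻¹) n n ≈ a n
    f[xy]·E⁻¹-diagonal n = begin
      (f[xy] · E⁻¹) n n                     ≈⟨ ·-coeff-single f[xy] E⁻¹ n n n n ℕP.≤-refl ℕP.≤-refl others≈0 ⟩
      f[xy] n n * E⁻¹ (n ∸ n) (n ∸ n)       ≈⟨ *-cong (reflexive (X.monomial-at n (a n))) (reflexive (≡.cong₂ E⁻¹ (ℕP.n∸n≡0 n) (ℕP.n∸n≡0 n))) ⟩
      a n * E⁻¹ 0 0                         ≈⟨ *-congˡ (E·-inverse-diagonal E⁻¹ E·E⁻¹≈1 XDominant-E⁻¹ 0) ⟩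
      a n * 1#                            ≈⟨ *-identityʳ _ ⟩
      a n                                 ∎
      where
      open import Relation.Binary.Reasoning.Setoid (CommutativeRing.setoid F)
      others≈0 : ∀ c₁ a₁ → c₁ ≤ n → a₁ ≤ n → (c₁ ≢ n ⊎ a₁ ≢ n) → f[xy] c₁ a₁ * E⁻¹ (n ∸ c₁) (n ∸ a₁) ≈ 0#
      others≈0 c₁ a₁ c₁≤n a₁≤n off with c₁ ℕP.≟ a₁
      ... | no  c₁≢a₁  = trans (*-congʳ (X.monomial-off c₁ (a c₁) a₁ (c₁≢a₁ ∘ ≡.sym))) (zeroˡ _)
      ... | yes ≡.refl = trans (*-congˡ (trans (E·-inverse-diagonal E⁻¹ E·E⁻¹≈1 XDominant-E⁻¹ (n ∸ c₁))
                                  (1₂-off (n ∸ c₁) (n ∸ c₁) (inj₁ (ℕP.m<n⇒0<n∸m (ℕP.≤∧≢⇒< c₁≤n ([ id , id ] off)))))))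
                               (zeroʳ _)

    diagonal-S·I : ∀ n → a n ≈ (S · I) n n
    diagonal-S·I n = sym (begin
      (S · I) n n                             ≈⟨ S·I≈y·E⁻¹+y·W·U⁻¹ n n ⟩
      (y · E⁻¹) n n + (y · (W · U⁻¹)) n n         ≈⟨ +-cong (y·E⁻¹≈y+f[xy]·E⁻¹ n n) (y·-diagonal (W · U⁻¹) (YDominant-· {W} YDominant-W YDominant-U⁻¹) n) ⟩
      (y n n + (f[xy] · E⁻¹) n n) + 0#          ≈⟨ +-identityʳ _ ⟩
      y n n + (f[xy] · E⁻¹) n n                 ≈⟨ +-cong (y-diagonal n) (f[xy]·E⁻¹-diagonal n) ⟩
      0# + a n                                ≈⟨ +-identityˡ _ ⟩
      a n                                     ∎)
      where open import Relation.Binary.Reasoning.Setoid (CommutativeRing.setoid F)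

module DiagonalSection {c ℓ} (F : CommutativeRing c ℓ) (q : ℕ) (isFiniteField : IsFiniteField F q)
                       {p k : ℕ} (p-prime : Prime p) (0<k : 0 < k) (q≡p^k : q ≡ p ℕ.^ k) where
  open CommutativeRing F using (trans)
  open Over F using (sumTo; _⊛_)
  open FiniteField F q isFiniteField using (q>0; fermat; characteristic)
  open Bivariate F

  private
    module XMult = Mult (CommutativeRing.semiring X.seriesRing)

    charX : ∀ s → (p XMult.× s) X.≋ X.zeroS
    charX = X.seriesRing-characteristic p (PrimeCharacteristic.characteristic F p-prime (characteristic 0<k q≡p^k))

    ^q-additiveX : ∀ u v → ((u X.⊕ v) X.^ˢ q) X.≋ ((u X.^ˢ q) X.⊕ (v X.^ˢ q))
    ^q-additiveX u v rewrite q≡p^k = PrimeCharacteristic.frobenius^-+ X.seriesRing p-prime (charX (Over.oneS F)) k u v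

    ^q-additiveY : ∀ u v → ((u ⊕ v) Y.^ˢ q) ≋₂ ((u Y.^ˢ q) ⊕ (v Y.^ˢ q))
    ^q-additiveY u v rewrite q≡p^k =
      PrimeCharacteristic.frobenius^-+ bivariateRing p-prime (Y.seriesRing-characteristic p charX 1₂) k u v

    -- By Fermat, s ^ q is the dilation of s itself.
    ^q-dilationX : ∀ s → X.Dilation q s (s X.^ˢ q)
    ^q-dilationX s = record
      { onMultiples  = λ m → trans (X.Dilation.onMultiples (X.^ˢ-dilation q>0 ^q-additiveX s) m) (fermat (s m))
      ; offMultiples = X.Dilation.offMultiples (X.^ˢ-dilation q>0 ^q-additiveX s) }

  section₂ : ℕ → Series₂ → Series₂
  section₂ j A c a = A (q ℕ.* c ℕ.+ j) (q ℕ.* a ℕ.+ j)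

  section₂-·-^q : ∀ A B j → j < q → section₂ j (A · (B Y.^ˢ q)) ≋₂ (section₂ j A · B)
  section₂-·-^q A B j j<q c a = begin
    (A · (B Y.^ˢ q)) N M
      ≈⟨ Y.⊛-comm A (B Y.^ˢ q) N M ⟩
    ((B Y.^ˢ q) · A) N M
      ≈⟨ Y.section-dilation⊛ q>0 (Y.^ˢ-dilation q>0 ^q-additiveY B) A j j<q c M ⟩
    Over.sumTo X.seriesRing (suc c) (λ c₁ → (B c₁ X.^ˢ q) ⊛ Y.section q j A (c ∸ c₁)) M
      ≈⟨ X.sumTo-coeff (suc c) _ M ⟩
    sumTo (suc c) (λ c₁ → ((B c₁ X.^ˢ q) ⊛ Y.section q j A (c ∸ c₁)) M)
      ≈⟨ FiniteSums.sumTo-cong F (suc c) (λ c₁ → X.section-dilation⊛ q>0 (^q-dilationX (B c₁)) (Y.section q j A (c ∸ c₁)) j j<q a) ⟩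
    sumTo (suc c) (λ c₁ → (B c₁ ⊛ section₂ j A (c ∸ c₁)) a)
      ≈⟨ X.sumTo-coeff (suc c) _ a ⟨
    (B · section₂ j A) c a
      ≈⟨ Y.⊛-comm B (section₂ j A) c a ⟩
    (section₂ j A · B) c a
      ∎
    where
    open import Relation.Binary.Reasoning.Setoid (CommutativeRing.setoid F)
    N = q ℕ.* c ℕ.+ j
    M = q ℕ.* a ℕ.+ j

module Kernel {c ℓ} (F : CommutativeRing c ℓ) (q : ℕ) (isFiniteField : IsFiniteField F q)
              {p k : ℕ} (p-prime : Prime p) (0<k : 0 < k) (q≡p^k : q ≡ p ℕ.^ k)
              (a : Over.Series F) (d′ h : ℕ) (P : Over.Poly2 F) where
  open CommutativeRing F
    using (_≈_; 0#; refl; sym; trans; reflexive; +-identityˡ; +-identityʳ)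
  open Over F using (Series)
  open IsFiniteField isFiniteField using (inverse; enum)
  open FiniteField F q isFiniteField using (q>0; q>1; index; enum-index)
  open Bivariate F
  open Furstenberg F a (suc d′) P
  open DiagonalSection F q isFiniteField p-prime 0<k q≡p^k
  open Horner bivariateRing using (horner; yDerivative)
  open import Data.Product using (_×_)
  open import Data.Nat.DivMod using (_/_; _%_; m≡m%n+[m/n]*n; m%n<n; m<n*o⇒m/o<n)
  open import Data.Fin as Fin using (Fin; toℕ; fromℕ<; combine; remQuot; finToFun; funToFin)
  open import Data.Fin.Properties using (toℕ-fromℕ<; remQuot-combine; finToFun-funToFin)
  private
    module B = CommutativeRing bivariateRing

  d : ℕ
  d = suc d′

  <h+1 : ∀ {i} → i ≤ h → i < h ℕ.+ 1
  <h+1 {i} i≤h = ℕP.≤-trans (s≤s i≤h) (ℕP.≤-reflexive (ℕP.+-comm 1 h))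

  q′ : ℕ
  q′ = q ∸ 1

  q≡1+q′ : q ≡ suc q′
  q≡1+q′ = ≡.sym (ℕP.m+[n∸m]≡n q>0)

  instance
    q≢0 : ℕ.NonZero q
    q≢0 = ℕ.>-nonZero q>0

  1*n+0≡n : ∀ n → 1 ℕ.* n ℕ.+ 0 ≡ n
  1*n+0≡n = solve-∀

  module _ (P-degX : ∀ i j → h < i → P i j ≈ 0#) where
    SupportedIn-yCoeff : ∀ j → SupportedIn h 0 0 (atXY (yCoeff j))
    SupportedIn-yCoeff j c i (inj₁ h<i) with i ℕP.≟ c
    ... | yes ≡.refl = trans (reflexive (X.monomial-at i (P i j))) (P-degX i j h<i)
    ... | no  i≢c    = X.monomial-off c _ i i≢c
    SupportedIn-yCoeff j c i (inj₂ (inj₁ c+0<i)) = X.monomial-off c _ i (ℕP.>⇒≢ (ℕP.≤-trans (s≤s (ℕP.≤-reflexive (≡.sym (ℕP.+-identityʳ c)))) c+0<i))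
    SupportedIn-yCoeff j c i (inj₂ (inj₂ i+0<c)) = X.monomial-off c _ i (ℕP.<⇒≢ (ℕP.≤-trans (s≤s (ℕP.≤-reflexive (≡.sym (ℕP.+-identityʳ i)))) i+0<c))

    private
      y·0₂ : ∀ {H lo hi} → SupportedIn H lo hi (y · zeroS)
      y·0₂ {H} {lo} {hi} = SupportedIn-cong {H} {lo} {hi} {zeroS} (B.sym {y · zeroS} (B.zeroʳ y)) (SupportedIn-zero {H} {lo} {hi})

      y·-supported : ∀ {n A} → SupportedIn h 0 n A → SupportedIn h 0 (suc n) (y · A)
      y·-supported {n} {A} A-supp = SupportedIn-· {0} {h} {0} {0} {1} {n} {y} SupportedIn-y A-supp

    SupportedIn-horner : ∀ n cf → (∀ j → SupportedIn h 0 0 (cf j)) → SupportedIn h 0 n (horner (suc n) cf y)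
    SupportedIn-horner zero    cf cf-supp = SupportedIn-⊕ {h} {0} {0} {cf 0} (cf-supp 0) y·0₂
    SupportedIn-horner (suc n) cf cf-supp = SupportedIn-⊕ {h} {0} {suc n} {cf 0}
      (SupportedIn-weaken {h} {0} {0} ℕP.≤-refl ℕP.≤-refl z≤n (cf-supp 0))
      (y·-supported (SupportedIn-horner n (cf ∘ suc) (cf-supp ∘ suc)))

    SupportedIn-yDerivative : ∀ n cf → (∀ j → SupportedIn h 0 0 (cf j)) → SupportedIn h 0 n (yDerivative y f[xy] (suc n) cf)
    SupportedIn-yDerivative zero    cf cf-supp = SupportedIn-⊕ {h} {0} {0} {y · zeroS} y·0₂ y·0₂
    SupportedIn-yDerivative (suc n) cf cf-supp = SupportedIn-⊕ {h} {0} {suc n} {y · horner (suc n) (cf ∘ suc) y}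
      (y·-supported (SupportedIn-horner n (cf ∘ suc) (cf-supp ∘ suc)))
      (y·-supported (SupportedIn-yDerivative n (cf ∘ suc) (cf-supp ∘ suc)))

    SupportedIn-S : SupportedIn h 0 d S
    SupportedIn-S = SupportedIn-yDerivative d (atXY ∘ yCoeff) SupportedIn-yCoeff

    SupportedIn-P[xy,y] : SupportedIn h 0 d P[xy,y]
    SupportedIn-P[xy,y] = SupportedIn-horner d (atXY ∘ yCoeff) SupportedIn-yCoeff

    SupportedIn-Q : SupportedIn h 1 d′ Q
    SupportedIn-Q c i (inj₁ h<i) = SupportedIn-P[xy,y] (suc c) i (inj₁ h<i)
    SupportedIn-Q c i (inj₂ (inj₁ c+1<i)) = SupportedIn-P[xy,y] (suc c) i (inj₂ (inj₁ (ℕP.≤-trans (s≤s (ℕP.≤-reflexive (≡.trans (ℕP.+-identityʳ (suc c)) (ℕP.+-comm 1 c)))) c+1<i)))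
    SupportedIn-Q c i (inj₂ (inj₂ i+d′<c)) = SupportedIn-P[xy,y] (suc c) i (inj₂ (inj₂ (ℕP.≤-trans (s≤s (ℕP.≤-reflexive (ℕP.+-suc i d′))) (s≤s i+d′<c))))

  -- The coefficients of a series in the box (h, 0, d′) are indexed by Fin (h + 1) × Fin d.
  boxSize : ℕ
  boxSize = (h ℕ.+ 1) ℕ.* d

  box : Fin (q ℕ.^ boxSize) → Series₂
  box x c i with i ℕP.≤? h | i ℕP.≤? c | (c ∸ i) ℕP.<? d
  ... | yes i≤h | yes _ | yes c∸i<d = enum (finToFun x (combine (fromℕ< (<h+1 i≤h)) (fromℕ< c∸i<d)))
  ... | _       | _     | _         = 0#

  box-covers : ∀ A → SupportedIn h 0 d′ A → ∃[ x ] (A ≋₂ box x)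
  box-covers A A-supp = funToFin coefficient , box≈A
    where
    coefficient : Fin boxSize → Fin q
    coefficient pos with remQuot {h ℕ.+ 1} d pos
    ... | i , e = index (A (toℕ i ℕ.+ toℕ e) (toℕ i))
    box≈A : A ≋₂ box (funToFin coefficient)
    box≈A c i with i ℕP.≤? h | i ℕP.≤? c | (c ∸ i) ℕP.<? d
    ... | yes i≤h | yes i≤c | yes c∸i<d = sym (begin
      enum (finToFun (funToFin coefficient) (combine i′ e′))   ≡⟨ ≡.cong enum (finToFun-funToFin coefficient (combine i′ e′)) ⟩
      enum (coefficient (combine i′ e′))                       ≡⟨ ≡.cong (λ ie → enum (index (A (toℕ (proj₁ ie) ℕ.+ toℕ (proj₂ ie)) (toℕ (proj₁ ie)))))
                                                                          (remQuot-combine {h ℕ.+ 1} {d} i′ e′) ⟩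
      enum (index (A (toℕ i′ ℕ.+ toℕ e′) (toℕ i′)))            ≈⟨ enum-index _ ⟩
      A (toℕ i′ ℕ.+ toℕ e′) (toℕ i′)                           ≡⟨ ≡.cong₂ A (≡.trans (≡.cong₂ ℕ._+_ (toℕ-fromℕ< (<h+1 i≤h)) (toℕ-fromℕ< c∸i<d)) (ℕP.m+[n∸m]≡n i≤c))
                                                                           (toℕ-fromℕ< (<h+1 i≤h)) ⟩
      A c i                                                    ∎)
      where
      open import Relation.Binary.Reasoning.Setoid (CommutativeRing.setoid F)
      i′ = fromℕ< (<h+1 i≤h)
      e′ = fromℕ< c∸i<d
    ... | no  i≰h | _       | _         = A-supp c i (inj₁ (ℕP.≰⇒> i≰h))
    ... | yes _   | no  i≰c | _         = A-supp c i (inj₂ (inj₁ (ℕP.≤-trans (s≤s (ℕP.≤-reflexive (ℕP.+-identityʳ c))) (ℕP.≰⇒> i≰c))))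
    ... | yes _   | yes i≤c | no  c∸i≮d = A-supp c i (inj₂ (inj₂ (ℕP.≤-trans (ℕP.≤-reflexive (≡.sym (ℕP.+-suc i d′)))
                                            (ℕP.≤-trans (ℕP.+-monoʳ-≤ i (ℕP.≮⇒≥ c∸i≮d)) (ℕP.≤-reflexive (ℕP.m+[n∸m]≡n i≤c))))))

  Q₀₀≈P₀₁ : Q 0 0 ≈ P 0 1
  Q₀₀≈P₀₁ = trans (+-identityˡ _)
    (trans (y·-coeff-suc (horner d (atXY ∘ yCoeff ∘ suc) y) 0 0)
      (trans (CommutativeRing.+-congˡ F (y·-coeff-zero (horner d′ (atXY ∘ yCoeff ∘ suc ∘ suc) y) 0)) (+-identityʳ _)))

  module _ (P₀₁≉0 : ¬ P 0 1 ≈ 0#) where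
    Q-invertible : ∃[ I ] ((Q · I) ≋₂ 1₂)
    Q-invertible = Y.unit-invertible Q (proj₁ Q₀⁻¹) (proj₂ Q₀⁻¹)
      where
      Q₀₀⁻¹ = inverse (Q 0 0) (P₀₁≉0 ∘ trans (sym Q₀₀≈P₀₁))
      Q₀⁻¹ = X.unit-invertible (Q 0) (proj₁ Q₀₀⁻¹) (proj₂ Q₀₀⁻¹)

    I : Series₂
    I = proj₁ Q-invertible

    Q·I≈1 : (Q · I) ≋₂ 1₂
    Q·I≈1 = proj₂ Q-invertible

    diagonalOver : Series₂ → Series
    diagonalOver A n = (A · I) n n

    reduce : ℕ → Series₂ → Series₂
    reduce j A = section₂ j (A · (Q Y.^ˢ q′))

    -- A/Q = A·Q^(q−1)/Q^q, and the q-th sections commute with division by Q^q.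
    diagonalOver-section : ∀ A j → j < q → ∀ n → diagonalOver A (q ℕ.* n ℕ.+ j) ≈ diagonalOver (reduce j A) n
    diagonalOver-section A j j<q n = trans (A·I≈A·Q^q′·I^q N N) (section₂-·-^q (A · (Q Y.^ˢ q′)) I j j<q n n)
      where
      open import Algebra.Properties.CommutativeSemiring.Exp (CommutativeRing.commutativeSemiring bivariateRing)
        using (^-distrib-*)
      N = q ℕ.* n ℕ.+ j
      1₂^ : ∀ n → (1₂ Y.^ˢ n) ≋₂ 1₂
      1₂^ zero    = B.refl {1₂}
      1₂^ (suc n) = B.trans {1₂ · (1₂ Y.^ˢ n)} (B.*-identityˡ (1₂ Y.^ˢ n)) (1₂^ n)
      A·I≈A·Q^q′·I^q : (A · I) ≋₂ ((A · (Q Y.^ˢ q′)) · (I Y.^ˢ q))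
      A·I≈A·Q^q′·I^q = B.sym {(A · (Q Y.^ˢ q′)) · (I Y.^ˢ q)} (begin
        (A · Q^q′) · (I Y.^ˢ q)          ≈⟨ B.*-congˡ {A · Q^q′} (Y.SeriesExp.^-congʳ I q≡1+q′) ⟩
        (A · Q^q′) · (I · (I Y.^ˢ q′))   ≈⟨ B.*-assoc A Q^q′ (I · (I Y.^ˢ q′)) ⟩
        A · (Q^q′ · (I · (I Y.^ˢ q′)))   ≈⟨ B.*-congˡ {A} (x·[y·z]≈y·[x·z] Q^q′ I (I Y.^ˢ q′)) ⟩
        A · (I · (Q^q′ · (I Y.^ˢ q′)))   ≈⟨ B.*-congˡ {A} (B.*-congˡ {I} (^-distrib-* Q I q′)) ⟨
        A · (I · ((Q · I) Y.^ˢ q′))      ≈⟨ B.*-congˡ {A} (B.*-congˡ {I} (B.trans {(Q · I) Y.^ˢ q′} (Y.SeriesExp.^-congˡ q′ {Q · I} {1₂} Q·I≈1) (1₂^ q′))) ⟩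
        A · (I · 1₂)                     ≈⟨ B.*-congˡ {A} (B.*-identityʳ I) ⟩
        A · I                            ∎)
        where
        open import Relation.Binary.Reasoning.Setoid B.setoid
        Q^q′ = Q Y.^ˢ q′
        x·[y·z]≈y·[x·z] : ∀ x y z → (x · (y · z)) ≋₂ (y · (x · z))
        x·[y·z]≈y·[x·z] x y z = B.trans {x · (y · z)} (B.sym {(x · y) · z} (B.*-assoc x y z))
          (B.trans {(x · y) · z} (B.*-congʳ {z} (B.*-comm x y)) (B.*-assoc y x z))

    SupportedIn-reduce : (∀ i j → h < i → P i j ≈ 0#) → ∀ {A} j → SupportedIn h 0 d A → SupportedIn h 0 d′ (reduce j A)
    SupportedIn-reduce P-degX {A} j A-supp c i out = A·Q^q′-supp (q ℕ.* c ℕ.+ j) (q ℕ.* i ℕ.+ j) out′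
      where
      A·Q^q′-supp : SupportedIn (h ℕ.+ q′ ℕ.* h) (0 ℕ.+ q′ ℕ.* 1) (d ℕ.+ q′ ℕ.* d′) (A · (Q Y.^ˢ q′))
      A·Q^q′-supp = SupportedIn-· {h} {q′ ℕ.* h} {0} {q′ ℕ.* 1} {d} {q′ ℕ.* d′} {A} A-supp
                      (SupportedIn-^ {h} {1} {d′} {Q} q′ (SupportedIn-Q P-degX))
      out′ : Outside (h ℕ.+ q′ ℕ.* h) (0 ℕ.+ q′ ℕ.* 1) (d ℕ.+ q′ ℕ.* d′) (q ℕ.* c ℕ.+ j) (q ℕ.* i ℕ.+ j)
      out′ = ≡.subst (λ q → Outside (h ℕ.+ q′ ℕ.* h) (0 ℕ.+ q′ ℕ.* 1) (d ℕ.+ q′ ℕ.* d′) (q ℕ.* c ℕ.+ j) (q ℕ.* i ℕ.+ j))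
               (≡.sym q≡1+q′) (Outside-section j (ℕP.≤-pred (ℕP.≤-trans q>1 (ℕP.≤-reflexive q≡1+q′))) out)

    -- Peeling off the least significant base-q digit j % q of the index.
    diagonalOver-digit : ∀ r j → j < q ℕ.^ suc r → ∀ A n →
      diagonalOver A (q ℕ.^ suc r ℕ.* n ℕ.+ j) ≈ diagonalOver (reduce (j % q) A) (q ℕ.^ r ℕ.* n ℕ.+ j / q)
    diagonalOver-digit r j _ A n =
      trans (reflexive (≡.cong (diagonalOver A) index≡)) (diagonalOver-section A (j % q) (m%n<n j q) (q ℕ.^ r ℕ.* n ℕ.+ j / q))
      where
      index≡ : q ℕ.^ suc r ℕ.* n ℕ.+ j ≡ q ℕ.* (q ℕ.^ r ℕ.* n ℕ.+ j / q) ℕ.+ j % q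
      index≡ = ≡.trans (≡.cong (q ℕ.^ suc r ℕ.* n ℕ.+_) (m≡m%n+[m/n]*n j q)) (lemma q (q ℕ.^ r) n (j % q) (j / q))
        where
        lemma : ∀ q q^r n x y → q ℕ.* q^r ℕ.* n ℕ.+ (x ℕ.+ y ℕ.* q) ≡ q ℕ.* (q^r ℕ.* n ℕ.+ y) ℕ.+ x
        lemma = solve-∀

    /q<q^r : ∀ r j → j < q ℕ.^ suc r → j / q < q ℕ.^ r
    /q<q^r r j j<q^[1+r] = m<n*o⇒m/o<n (ℕP.≤-trans j<q^[1+r] (ℕP.≤-reflexive (ℕP.*-comm q (q ℕ.^ r))))

    diagonalOver-kernel : (∀ i j → h < i → P i j ≈ 0#) → ∀ r j → j < q ℕ.^ r → ∀ A → SupportedIn h 0 d′ A →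
      ∃[ A′ ] (SupportedIn h 0 d′ A′ × ∀ n → diagonalOver A (q ℕ.^ r ℕ.* n ℕ.+ j) ≈ diagonalOver A′ n)
    diagonalOver-kernel P-degX zero    zero    _ A A-supp = A , A-supp , λ n → reflexive (≡.cong (diagonalOver A) (1*n+0≡n n))
    diagonalOver-kernel P-degX zero    (suc j) (s≤s ())
    diagonalOver-kernel P-degX (suc r) j j<q^[1+r] A A-supp =
      let A′ , A′-supp , reduced≈A′ =
            diagonalOver-kernel P-degX r (j / q) (/q<q^r r j j<q^[1+r]) (reduce (j % q) A)
              (SupportedIn-reduce P-degX (j % q) (SupportedIn-weaken {h} {0} {d′} {A = A} ℕP.≤-refl ℕP.≤-refl (ℕP.n≤1+n d′) A-supp))
      in A′ , A′-supp , λ n → trans (diagonalOver-digit r j j<q^[1+r] A n) (reduced≈A′ n)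

    kernelCardAtMost : (∀ i j → h < i → P i j ≈ 0#) → a 0 ≈ 0# → (∀ n → Over.evalCoeff F P h d a n ≈ 0#) →
      Over.KernelCardAtMost F q a (kernelBound q h d)
    kernelCardAtMost P-degX a₀≈0 P[x,f]≈0 = kernelElement , kernel-covered
      where
      open Residue a₀≈0 (P[xy,f[xy]]≋0 P-degX P[x,f]≈0) I Q·I≈1 using (diagonal-S·I)

      kernelElement : Fin (kernelBound q h d) → Series
      kernelElement Fin.zero    = a
      kernelElement (Fin.suc x) = diagonalOver (box x)

      kernel-covered : ∀ r j → j < q ℕ.^ r → ∃[ k ] (∀ n → a (q ℕ.^ r ℕ.* n ℕ.+ j) ≈ kernelElement k n)
      kernel-covered zero    zero    _ = Fin.zero , λ n → reflexive (≡.cong a (1*n+0≡n n))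
      kernel-covered zero    (suc j) (s≤s ())
      kernel-covered (suc r) j j<q^[1+r] =
        let A′ , A′-supp , reduced≈A′ =
              diagonalOver-kernel P-degX r (j / q) (/q<q^r r j j<q^[1+r]) (reduce (j % q) S)
                (SupportedIn-reduce P-degX (j % q) (SupportedIn-S P-degX))
            x , A′≋box = box-covers A′ A′-supp
        in Fin.suc x , λ n → begin
          a (q ℕ.^ suc r ℕ.* n ℕ.+ j)                               ≈⟨ diagonal-S·I _ ⟩
          diagonalOver S (q ℕ.^ suc r ℕ.* n ℕ.+ j)                  ≈⟨ diagonalOver-digit r j j<q^[1+r] S n ⟩
          diagonalOver (reduce (j % q) S) (q ℕ.^ r ℕ.* n ℕ.+ j / q) ≈⟨ reduced≈A′ n ⟩
          diagonalOver A′ n                                         ≈⟨ Y.⊛-cong {A′} {box x} {I} A′≋box (λ _ _ → refl) n n ⟩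
          diagonalOver (box x) n                                    ∎
        where open import Relation.Binary.Reasoning.Setoid (CommutativeRing.setoid F)

∂y-at00 : ∀ {c ℓ} (F : CommutativeRing c ℓ) (P : Over.Poly2 F) → Over._≈_ F (Over.at00 F (Over.∂y F P)) (P 0 1)
∂y-at00 F P = CommutativeRing.+-identityʳ F (P 0 1)

theorem3p1 : {c ℓ : Level} (F : CommutativeRing c ℓ) (q : ℕ) →
    IsPrimePower q → IsFiniteField F q →
    let open Over F in
    (a : Series) (d h : ℕ) (P : Poly2) →
    a 0 ≈ 0# →
    Irreducible P → DegY P d → DegX P h →
    (∀ n → evalCoeff P h d a n ≈ 0#) →
    ¬ (at00 (∂y P) ≈ 0#) →
    KernelCardAtMost q a (kernelBound q h d)
theorem3p1 F q _ _ a zero h P _ _ (P-degY , _) _ _ ∂yP₀₀≉0 =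
  ⊥-elim (∂yP₀₀≉0 (CommutativeRing.trans F (∂y-at00 F P) (P-degY 0 1 (s≤s z≤n))))
theorem3p1 F q (p , k , p-prime , 1≤k , q≡p^k) isFiniteField a (suc d′) h P a₀≈0 _ _ (P-degX , _) P[x,f]≈0 ∂yP₀₀≉0 =
  Kernel.kernelCardAtMost F q isFiniteField p-prime 1≤k q≡p^k a d′ h P
    (∂yP₀₀≉0 ∘ CommutativeRing.trans F (∂y-at00 F P)) P-degX a₀≈0 P[x,f]≈0
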